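{- Let $F(t)=-t^2$ and $G(t)=t^3-1$. Let $f,g\in\mathbb{Q}[t]$ with $\deg f=2$, $\deg g=3$. Then $g$ divides $f^3+1$ and $f$ divides $g^3+1$ in $\mathbb{Q}[t]$ if and only if there exist $\alpha\in\mathbb{Q}\setminus\{0\}$ and $\beta\in\mathbb{Q}$ such that $f(t)=F(\alpha t+\beta)$ and $g(t)=G(\alpha t+\beta)$.
   Context: Solutions are considered up to affine reparametrization $t\mapsto\alpha t+\beta$ ($\alpha\in\mathbb{Q}\setminus\{0\}$, $\beta\in\mathbb{Q}$). (Since $\gcd(2,3)=1$, no such pair is a composition $f=f_1\circ h$, $g=g_1\circ h$ with $\deg h\ge 2$.) -}

module Defs where

open import Data.Nat using (ℕ; zero; suc; _<_)
open import Data.List using (List; []; _∷_; map; foldr)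
open import Data.Rational using (ℚ; 0ℚ; 1ℚ; -_; _+_; _*_)
open import Data.Product using (Σ; _×_)
open import Relation.Binary.PropositionalEquality using (_≡_; _≢_)

-- Polynomials in ℚ[t] as coefficient lists, lowest degree first.
-- Trailing zeros are allowed; polynomial equality is coefficientwise (_≈ₚ_).
Poly : Set
Poly = List ℚ

infixl 6 _+ₚ_
infixl 7 _*ₚ_
infix 4 _≈ₚ_ _∣ₚ_

_+ₚ_ : Poly → Poly → Poly
[] +ₚ q = q
(a ∷ p) +ₚ [] = a ∷ p
(a ∷ p) +ₚ (b ∷ q) = (a + b) ∷ (p +ₚ q)

scaleₚ : ℚ → Poly → Poly
scaleₚ a p = map (a *_) p

_*ₚ_ : Poly → Poly → Poly
[] *ₚ q = []
(a ∷ p) *ₚ q = scaleₚ a q +ₚ (0ℚ ∷ (p *ₚ q))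

coeff : Poly → ℕ → ℚ
coeff [] n = 0ℚ
coeff (a ∷ p) zero = a
coeff (a ∷ p) (suc n) = coeff p n

_≈ₚ_ : Poly → Poly → Set
p ≈ₚ q = ∀ n → coeff p n ≡ coeff q n

_∣ₚ_ : Poly → Poly → Set
g ∣ₚ p = Σ Poly λ h → g *ₚ h ≈ₚ p

HasDegree : Poly → ℕ → Set
HasDegree p d = (coeff p d ≢ 0ℚ) × (∀ n → d < n → coeff p n ≡ 0ℚ)

composeₚ : Poly → Poly → Poly
composeₚ p q = foldr (λ a acc → (a ∷ []) +ₚ (q *ₚ acc)) [] p

oneₚ : Poly
oneₚ = 1ℚ ∷ []

cubeₚ : Poly → Poly
cubeₚ p = p *ₚ p *ₚ p

Fₚ : Poly
Fₚ = 0ℚ ∷ 0ℚ ∷ (- 1ℚ) ∷ []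

Gₚ : Poly
Gₚ = (- 1ℚ) ∷ 0ℚ ∷ 0ℚ ∷ 1ℚ ∷ []

linₚ : ℚ → ℚ → Poly
linₚ α β = β ∷ α ∷ []

{-# OPTIONS --safe #-}
-- Put f = a (x² − s) with x = t + σ and divide: g = f · (l x + y) + (u x + v). Evaluating in ℚ[x]/(x² − s),
-- f ∣ g³ + 1 says (v + u x)³ = −1; evaluating in ℚ[x]/(g), where f (l x + y) = −(u x + v) and f³ = −1, g ∣ f³ + 1
-- says (l x + y)³ = (u x + v)³. For u = 0 this forces v = −1, y = s = 0 and a = −l², that is f = F(−l x) and
-- g = G(−l x). For u ≠ 0 it forces v = ½ and u² s = −¾, and eliminating a, s and y leaves
-- 8 m (m³ − 1)² (3 m⁶ + 5 m³ + 1) = 0 for m = l/u. As 13 is not a rational square, m = 1, then y = ½, so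
-- g = (f + 1)(u x + ½); the root of u x + ½ is then a double root of f³ + 1, hence the vertex x = 0 of f, which
-- is absurd. Conversely F³ + 1 and G³ + 1 have the explicit cofactors −(t³ + 1) and −t(t⁶ − 3t³ + 3).
module Submission where

open import Defs
open import Data.Rational using (ℚ; 0ℚ)
open import Data.Product using (Σ; _×_)
open import Function.Bundles using (_⇔_)
open import Relation.Binary.PropositionalEquality using (_≢_)

open import Level using (0ℓ)
open import Agda.Builtin.FromNat using (Number; fromNat)
open import Algebra.Bundles using (CommutativeRing; CommutativeSemiring)
open import Algebra.Core using (Op₂)
open import Algebra.Definitions using (Associative; Commutative; LeftIdentity; LeftZero; _DistributesOverʳ_)
open import Algebra.Structures using (IsCommutativeSemiring)
open import Algebra.Structures.Biased using (isCommutativeSemiringˡ; isCommutativeMonoidˡ)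
import Algebra.Properties.CommutativeSemigroup as CommutativeSemigroupProperties
open import Data.Unit.Base using (tt)
open import Data.Empty using (⊥; ⊥-elim)
open import Data.Product using (_,_; proj₁; proj₂)
open import Data.Sum using (reduce)
open import Data.List.Base using (List; []; _∷_; applyUpTo)
open import Data.Nat.Base as ℕ using (ℕ; zero; suc; s≤s)
import Data.Nat.Literals as ℕ
import Data.Nat.Properties as ℕ
open import Data.Nat.Divisibility using (_∣_; divides; quotient)
open import Data.Nat.Coprimality as Coprimality using (Coprime)
open import Data.Nat.Primality using (Prime; prime?; euclidsLemma; ¬prime[1]; prime⇒nonZero)
import Data.Nat.Tactic.RingSolver as ℕ-Solver
import Data.Integer.Base as ℤ
import Data.Integer.Properties as ℤ
open import Data.Rational.Base using (mkℚ; 1ℚ; ½; _+_; _*_; -_; _-_; 1/_; _≤_; *≤*; ≢-nonZero; toℚᵘ)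
import Data.Rational.Literals as ℚ
import Data.Rational.Properties as ℚ
open import Data.Rational.Properties
  using (_≟_; +-*-commutativeRing; heytingCommutativeRing; *-inverseʳ; 1≢0; neg-injective; toℚᵘ-homo-*
        ; nonNeg*nonNeg⇒nonNeg; neg*neg⇒pos; nonNegative⁻¹; pos⇒nonNeg)
import Data.Rational.Unnormalised.Base as ℚᵘ
import Data.Rational.Unnormalised.Properties as ℚᵘ
open import Algebra.Apartness.Properties.HeytingCommutativeRing heytingCommutativeRing using (x#0y#0→xy#0)
open import Algebra.Properties.Group (CommutativeRing.+-group +-*-commutativeRing) using (x∙y⁻¹≈ε⇒x≈y)
import Tactic.RingSolver.Core.AlmostCommutativeRing as ACR
open import Tactic.RingSolver using (solve)
open import Function.Base using (_∘_)
open import Function.Bundles using (mk⇔)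
open import Relation.Nullary using (¬_; yes; no)
open import Relation.Nullary.Decidable using (decidable-stable; dec⇒maybe; from-yes)
open import Relation.Binary.Bundles using (Setoid)
import Relation.Binary.Reasoning.Setoid
open import Relation.Binary.PropositionalEquality

instance
  ℕ-number : Number ℕ
  ℕ-number = ℕ.number

  ℚ-number : Number ℚ
  ℚ-number = ℚ.number

ℚ-ring : ACR.AlmostCommutativeRing 0ℓ 0ℓ
ℚ-ring = ACR.fromCommutativeRing +-*-commutativeRing (λ x → dec⇒maybe (0ℚ ≟ x))

*-≢0 : ∀ {x y} → x ≢ 0ℚ → y ≢ 0ℚ → x * y ≢ 0ℚ
*-≢0 = x#0y#0→xy#0

x*y≡0⇒y≡0 : ∀ {x y} → x ≢ 0ℚ → x * y ≡ 0ℚ → y ≡ 0ℚ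
x*y≡0⇒y≡0 {y = y} x≢0 xy≡0 = decidable-stable (y ≟ 0ℚ) (λ y≢0 → *-≢0 x≢0 y≢0 xy≡0)

x-y≡0⇒x≡y : ∀ {x y} → x - y ≡ 0ℚ → x ≡ y
x-y≡0⇒x≡y = x∙y⁻¹≈ε⇒x≈y _ _

combine₁ : ∀ {a b x y} → a ≡ b → ∀ k → x - y ≡ k * (a - b) → x ≡ y
combine₁ {a} refl k eq = x-y≡0⇒x≡y (trans eq (solve (a ∷ k ∷ []) ℚ-ring))

combine₂ : ∀ {a b c d x y} → a ≡ b → c ≡ d → ∀ k l → x - y ≡ k * (a - b) + l * (c - d) → x ≡ y
combine₂ {a} {c = c} refl refl k l eq = x-y≡0⇒x≡y (trans eq (solve (a ∷ c ∷ k ∷ l ∷ []) ℚ-ring))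

combine₃ : ∀ {a b c d e f x y} → a ≡ b → c ≡ d → e ≡ f → ∀ k l m →
  x - y ≡ k * (a - b) + l * (c - d) + m * (e - f) → x ≡ y
combine₃ {a} {c = c} {e = e} refl refl refl k l m eq = x-y≡0⇒x≡y (trans eq (solve (a ∷ c ∷ e ∷ k ∷ l ∷ m ∷ []) ℚ-ring))

square-nonNeg : ∀ r → 0ℚ ≤ r * r
square-nonNeg r@(mkℚ (ℤ.+ _) _ _) = nonNegative⁻¹ (r * r) {{nonNeg*nonNeg⇒nonNeg r r}}
square-nonNeg r@(mkℚ ℤ.-[1+ _ ] _ _) = nonNegative⁻¹ (r * r) {{pos⇒nonNeg (r * r) {{neg*neg⇒pos r r}}}}

cancel-inverse : ∀ {x i} y → x * i ≡ 1ℚ → x * (y * i) ≡ y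
cancel-inverse {x} {i} y xi≡1 = combine₁ xi≡1 y (solve (x ∷ y ∷ i ∷ []) ℚ-ring)

-- If x ≠ y then x² + x y + y² = 0, so ((2 x + y)/y)² = −3.
cube-injective : ∀ {x y} → x * x * x ≡ y * y * y → x ≡ y
cube-injective {x} {y} x³≡y³ with y ≟ 0ℚ
... | yes refl = decidable-stable (x ≟ 0ℚ) (λ x≢0 → *-≢0 (*-≢0 x≢0 x≢0) x≢0 x³≡y³)
... | no y≢0 = decidable-stable (x ≟ y) λ x≢y →
  0≰-3 (subst (0ℚ ≤_) (r²≡-3 x≢y (*-inverseʳ y)) (square-nonNeg ((x + x + y) * 1/ y)))
  where
  instance _ = ≢-nonZero y≢0
  0≰-3 : ¬ 0ℚ ≤ - 3
  0≰-3 (*≤* ())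
  r²≡-3 : x ≢ y → ∀ {i} → y * i ≡ 1ℚ → (x + x + y) * i * ((x + x + y) * i) ≡ - 3
  r²≡-3 x≢y {i} yi≡1 = combine₂ x²+xy+y²≡0 yi≡1 (4 * i * i) (- 3 * (y * i + 1ℚ)) (solve (x ∷ y ∷ i ∷ []) ℚ-ring)
    where
    x²+xy+y²≡0 : x * x + x * y + y * y ≡ 0ℚ
    x²+xy+y²≡0 = x*y≡0⇒y≡0 (x≢y ∘ x-y≡0⇒x≡y) (combine₁ x³≡y³ 1ℚ (solve (x ∷ y ∷ []) ℚ-ring))

-- Irrationality of √p

square≢prime*square : ∀ {p m n} → Prime p → Coprime m n → m ℕ.* m ≢ p ℕ.* (n ℕ.* n)
square≢prime*square {p} {m} {n} p-prime m⊥n m²≡pn² = ¬prime[1] (subst Prime (m⊥n (p∣m , p∣n)) p-prime)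
  where
  instance _ = prime⇒nonZero p-prime
  p∣square⇒p∣ : ∀ {k} → p ∣ k ℕ.* k → p ∣ k
  p∣square⇒p∣ {k} p∣k² = reduce (euclidsLemma k k p-prime p∣k²)
  p∣m : p ∣ m
  p∣m = p∣square⇒p∣ (divides (n ℕ.* n) (trans m²≡pn² (ℕ.*-comm p (n ℕ.* n))))
  q = quotient p∣m
  n²≡q²p : n ℕ.* n ≡ q ℕ.* q ℕ.* p
  n²≡q²p = ℕ.*-cancelˡ-≡ _ _ p (begin
    p ℕ.* (n ℕ.* n)         ≡⟨ sym m²≡pn² ⟩
    m ℕ.* m                 ≡⟨ cong (λ k → k ℕ.* k) (_∣_.equality p∣m) ⟩
    q ℕ.* p ℕ.* (q ℕ.* p)   ≡⟨ rearrange q p ⟩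
    p ℕ.* (q ℕ.* q ℕ.* p)   ∎)
    where
    open ≡-Reasoning
    rearrange : ∀ q p → q ℕ.* p ℕ.* (q ℕ.* p) ≡ p ℕ.* (q ℕ.* q ℕ.* p)
    rearrange = ℕ-Solver.solve-∀
  p∣n : p ∣ n
  p∣n = p∣square⇒p∣ (divides (q ℕ.* q) n²≡q²p)

square≢prime : ∀ {p} → Prime p → ∀ r → r * r ≢ ℚ.fromℤ (ℤ.+ p)
square≢prime {p} p-prime r@(mkℚ n d n⊥d) r²≡p =
  square≢prime*square p-prime (Coprimality.recompute n⊥d) (begin
    ℤ.∣ n ∣ ℕ.* ℤ.∣ n ∣                     ≡⟨ ℤ.abs-* n n ⟨
    ℤ.∣ n ℤ.* n ∣                           ≡⟨ cong ℤ.∣_∣ n²≡pD² ⟩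
    ℤ.∣ ℤ.+ p ℤ.* (ℤ.+ D ℤ.* ℤ.+ D) ∣       ≡⟨ ℤ.abs-* (ℤ.+ p) (ℤ.+ D ℤ.* ℤ.+ D) ⟩
    p ℕ.* ℤ.∣ ℤ.+ D ℤ.* ℤ.+ D ∣             ≡⟨ cong (p ℕ.*_) (ℤ.abs-* (ℤ.+ D) (ℤ.+ D)) ⟩
    p ℕ.* (D ℕ.* D)                         ∎)
  where
  open ≡-Reasoning
  D = suc d
  n²≡pD² : n ℤ.* n ≡ ℤ.+ p ℤ.* (ℤ.+ D ℤ.* ℤ.+ D)
  n²≡pD² with ℚᵘ.≃-trans (ℚᵘ.≃-sym (toℚᵘ-homo-* r r)) (ℚᵘ.≃-reflexive (cong toℚᵘ r²≡p))
  ... | ℚᵘ.*≡* eq = trans (sym (ℤ.*-identityʳ (n ℤ.* n))) eq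

≈ₚ-refl : ∀ {p} → p ≈ₚ p
≈ₚ-refl n = refl

≈ₚ-sym : ∀ {p q} → p ≈ₚ q → q ≈ₚ p
≈ₚ-sym p≈q n = sym (p≈q n)

≈ₚ-trans : ∀ {p q r} → p ≈ₚ q → q ≈ₚ r → p ≈ₚ r
≈ₚ-trans p≈q q≈r n = trans (p≈q n) (q≈r n)

≈ₚ-setoid : Setoid 0ℓ 0ℓ
≈ₚ-setoid = record
  { Carrier = Poly
  ; _≈_ = _≈ₚ_
  ; isEquivalence = record
    { refl = λ {p} → ≈ₚ-refl {p}
    ; sym = λ {p} {q} → ≈ₚ-sym {p} {q}
    ; trans = λ {p} {q} {r} → ≈ₚ-trans {p} {q} {r}
    }
  }

module ≈ₚ-Reasoning = Relation.Binary.Reasoning.Setoid ≈ₚ-setoid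

∷-cong : ∀ {a b p q} → a ≡ b → p ≈ₚ q → a ∷ p ≈ₚ b ∷ q
∷-cong a≡b p≈q zero    = a≡b
∷-cong a≡b p≈q (suc n) = p≈q n

coeff-+ₚ : ∀ p q n → coeff (p +ₚ q) n ≡ coeff p n + coeff q n
coeff-+ₚ []      q       n       = sym (ℚ.+-identityˡ (coeff q n))
coeff-+ₚ (a ∷ p) []      n       = sym (ℚ.+-identityʳ (coeff (a ∷ p) n))
coeff-+ₚ (a ∷ p) (b ∷ q) zero    = refl
coeff-+ₚ (a ∷ p) (b ∷ q) (suc n) = coeff-+ₚ p q n

coeff-scaleₚ : ∀ a p n → coeff (scaleₚ a p) n ≡ a * coeff p n
coeff-scaleₚ a []      n       = sym (ℚ.*-zeroʳ a)
coeff-scaleₚ a (b ∷ p) zero    = refl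
coeff-scaleₚ a (b ∷ p) (suc n) = coeff-scaleₚ a p n

+ₚ-cong : ∀ {p p′ q q′} → p ≈ₚ p′ → q ≈ₚ q′ → p +ₚ q ≈ₚ p′ +ₚ q′
+ₚ-cong {p} {p′} {q} {q′} p≈p′ q≈q′ n = begin
  coeff (p +ₚ q) n          ≡⟨ coeff-+ₚ p q n ⟩
  coeff p n + coeff q n     ≡⟨ cong₂ _+_ (p≈p′ n) (q≈q′ n) ⟩
  coeff p′ n + coeff q′ n   ≡⟨ coeff-+ₚ p′ q′ n ⟨
  coeff (p′ +ₚ q′) n        ∎
  where open ≡-Reasoning

scaleₚ-cong : ∀ {a b p q} → a ≡ b → p ≈ₚ q → scaleₚ a p ≈ₚ scaleₚ b q
scaleₚ-cong {a} {b} {p} {q} a≡b p≈q n = begin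
  coeff (scaleₚ a p) n  ≡⟨ coeff-scaleₚ a p n ⟩
  a * coeff p n         ≡⟨ cong₂ _*_ a≡b (p≈q n) ⟩
  b * coeff q n         ≡⟨ coeff-scaleₚ b q n ⟨
  coeff (scaleₚ b q) n  ∎
  where open ≡-Reasoning

*ₚ-zeroˡ : ∀ p q → p ≈ₚ [] → p *ₚ q ≈ₚ []
*ₚ-zeroˡ []      q p≈0 = ≈ₚ-refl {[]}
*ₚ-zeroˡ (a ∷ p) q p≈0 n = begin
  coeff (scaleₚ a q +ₚ (0ℚ ∷ p *ₚ q)) n          ≡⟨ coeff-+ₚ (scaleₚ a q) (0ℚ ∷ p *ₚ q) n ⟩
  coeff (scaleₚ a q) n + coeff (0ℚ ∷ p *ₚ q) n   ≡⟨ cong₂ _+_ (coeff-scaleₚ a q n) (shifted-zero n) ⟩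
  a * coeff q n + 0ℚ                             ≡⟨ cong (λ x → x * coeff q n + 0ℚ) (p≈0 0) ⟩
  0ℚ * coeff q n + 0ℚ                            ≡⟨ cong (_+ 0ℚ) (ℚ.*-zeroˡ (coeff q n)) ⟩
  0ℚ                                             ∎
  where
  open ≡-Reasoning
  shifted-zero : ∀ n → coeff (0ℚ ∷ p *ₚ q) n ≡ 0ℚ
  shifted-zero zero    = refl
  shifted-zero (suc n) = *ₚ-zeroˡ p q (p≈0 ∘ suc) n

*ₚ-congˡ : ∀ p p′ q → p ≈ₚ p′ → p *ₚ q ≈ₚ p′ *ₚ q
*ₚ-congˡ []      []        q p≈p′ = ≈ₚ-refl {[]}
*ₚ-congˡ []      (a′ ∷ p′) q p≈p′ =
  ≈ₚ-sym {(a′ ∷ p′) *ₚ q} {[]} (*ₚ-zeroˡ (a′ ∷ p′) q (≈ₚ-sym {[]} {a′ ∷ p′} p≈p′))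
*ₚ-congˡ (a ∷ p) []        q p≈p′ = *ₚ-zeroˡ (a ∷ p) q p≈p′
*ₚ-congˡ (a ∷ p) (a′ ∷ p′) q p≈p′ =
  +ₚ-cong {scaleₚ a q} {scaleₚ a′ q} {0ℚ ∷ p *ₚ q} {0ℚ ∷ p′ *ₚ q}
    (scaleₚ-cong {a} {a′} {q} {q} (p≈p′ 0) (≈ₚ-refl {q}))
    (∷-cong {0ℚ} {0ℚ} {p *ₚ q} {p′ *ₚ q} refl (*ₚ-congˡ p p′ q (p≈p′ ∘ suc)))

*ₚ-congʳ : ∀ p q q′ → q ≈ₚ q′ → p *ₚ q ≈ₚ p *ₚ q′
*ₚ-congʳ []      q q′ q≈q′ = ≈ₚ-refl {[]}
*ₚ-congʳ (a ∷ p) q q′ q≈q′ =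
  +ₚ-cong {scaleₚ a q} {scaleₚ a q′} {0ℚ ∷ p *ₚ q} {0ℚ ∷ p *ₚ q′}
    (scaleₚ-cong {a} {a} {q} {q′} refl q≈q′)
    (∷-cong {0ℚ} {0ℚ} {p *ₚ q} {p *ₚ q′} refl (*ₚ-congʳ p q q′ q≈q′))

*ₚ-cong : ∀ {p p′ q q′} → p ≈ₚ p′ → q ≈ₚ q′ → p *ₚ q ≈ₚ p′ *ₚ q′
*ₚ-cong {p} {p′} {q} {q′} p≈p′ q≈q′ = begin
  p *ₚ q     ≈⟨ *ₚ-congˡ p p′ q p≈p′ ⟩
  p′ *ₚ q    ≈⟨ *ₚ-congʳ p′ q q′ q≈q′ ⟩
  p′ *ₚ q′   ∎
  where open ≈ₚ-Reasoning

cubeₚ-cong : ∀ {p q} → p ≈ₚ q → cubeₚ p ≈ₚ cubeₚ q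
cubeₚ-cong {p} {q} p≈q = *ₚ-cong {p *ₚ p} {q *ₚ q} {p} {q} (*ₚ-cong {p} {q} {p} {q} p≈q p≈q) p≈q

∣ₚ-resp-≈ₚ : ∀ {g g′ p p′} → g ≈ₚ g′ → p ≈ₚ p′ → g ∣ₚ p → g′ ∣ₚ p′
∣ₚ-resp-≈ₚ {g} {g′} {p} {p′} g≈g′ p≈p′ (h , gh≈p) = h , (begin
  g′ *ₚ h   ≈⟨ *ₚ-congˡ g g′ h g≈g′ ⟨
  g *ₚ h    ≈⟨ gh≈p ⟩
  p         ≈⟨ p≈p′ ⟩
  p′        ∎)
  where open ≈ₚ-Reasoning

∣ₚ-cube+1-resp-≈ₚ : ∀ {g g′ f f′} → g ≈ₚ g′ → f ≈ₚ f′ → g ∣ₚ cubeₚ f +ₚ oneₚ → g′ ∣ₚ cubeₚ f′ +ₚ oneₚ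
∣ₚ-cube+1-resp-≈ₚ {g} {g′} {f} {f′} g≈g′ f≈f′ = ∣ₚ-resp-≈ₚ {g} {g′} {cubeₚ f +ₚ oneₚ} {cubeₚ f′ +ₚ oneₚ} g≈g′
  (+ₚ-cong {cubeₚ f} {cubeₚ f′} {oneₚ} {oneₚ} (cubeₚ-cong {f} {f′} f≈f′) (≈ₚ-refl {oneₚ}))

infix  4 _≋_
infixr 5 _∷_ _∷0_

-- Being an inductive family,
-- it exposes each entry of concretely shaped lists as a ring expression that the solver can check.
data _≋_ : Poly → Poly → Set where
  []   : [] ≋ []
  _∷_  : ∀ {a b p q} → a ≡ b → p ≋ q → a ∷ p ≋ b ∷ q
  _∷0_ : ∀ {a p} → a ≡ 0ℚ → p ≋ [] → a ∷ p ≋ []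

≋⇒≈ₚ : ∀ {p q} → p ≋ q → p ≈ₚ q
≋⇒≈ₚ []                n       = refl
≋⇒≈ₚ (a≡b ∷ p≋q)       zero    = a≡b
≋⇒≈ₚ (a≡b ∷ p≋q)       (suc n) = ≋⇒≈ₚ p≋q n
≋⇒≈ₚ (a≡0 ∷0 p≋[])     zero    = a≡0
≋⇒≈ₚ (a≡0 ∷0 p≋[])     (suc n) = ≋⇒≈ₚ p≋[] n

coeff-applyUpTo-< : ∀ f {k i} → i ℕ.< k → coeff (applyUpTo f k) i ≡ f i
coeff-applyUpTo-< f {suc k} {zero}  _         = refl
coeff-applyUpTo-< f {suc k} {suc i} (s≤s i<k) = coeff-applyUpTo-< (f ∘ suc) i<k

coeff-applyUpTo-≥ : ∀ f {k i} → k ℕ.≤ i → coeff (applyUpTo f k) i ≡ 0ℚ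
coeff-applyUpTo-≥ f {zero}          _         = refl
coeff-applyUpTo-≥ f {suc k} {suc i} (s≤s k≤i) = coeff-applyUpTo-≥ (f ∘ suc) k≤i

HasDegree⇒≈ₚ-coefficients : ∀ {p n} → HasDegree p n → p ≈ₚ applyUpTo (coeff p) (suc n)
HasDegree⇒≈ₚ-coefficients {p} {n} (_ , vanishes) i with i ℕ.≤? n
... | yes i≤n = sym (coeff-applyUpTo-< (coeff p) (s≤s i≤n))
... | no  i≰n = trans (vanishes i (ℕ.≰⇒> i≰n)) (sym (coeff-applyUpTo-≥ (coeff p) (ℕ.≰⇒> i≰n)))

-- Evaluation in commutative ℚ-algebras

-- Equality is propositional, so that coordinates of elements can be compared.
record ℚ-Algebra : Set₁ where
  infixl 6 _⊕_
  infixl 7 _⊗_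
  field
    Carrier : Set
    _⊕_ _⊗_ : Carrier → Carrier → Carrier
    ι : ℚ → Carrier
    isCommutativeSemiring : IsCommutativeSemiring _≡_ _⊕_ _⊗_ (ι 0ℚ) (ι 1ℚ)
    ι-+ : ∀ a b → ι (a + b) ≡ ι a ⊕ ι b
    ι-* : ∀ a b → ι (a * b) ≡ ι a ⊗ ι b

  open IsCommutativeSemiring isCommutativeSemiring public
    using ( +-assoc; +-comm; +-identityˡ; +-identityʳ; *-assoc; *-comm; *-identityˡ
          ; distribˡ; distribʳ; zeroˡ; zeroʳ)

  commutativeSemiring : CommutativeSemiring 0ℓ 0ℓ
  commutativeSemiring = record { isCommutativeSemiring = isCommutativeSemiring }

  cube : Carrier → Carrier
  cube x = x ⊗ x ⊗ x

  eval : Carrier → Poly → Carrier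
  eval x []      = ι 0ℚ
  eval x (a ∷ p) = ι a ⊕ x ⊗ eval x p

module Evaluation (A : ℚ-Algebra) where
  open ℚ-Algebra A
  open CommutativeSemigroupProperties (CommutativeSemiring.+-commutativeSemigroup commutativeSemiring)
    using () renaming (interchange to ⊕-interchange)
  open CommutativeSemigroupProperties (CommutativeSemiring.*-commutativeSemigroup commutativeSemiring)
    using () renaming (interchange to ⊗-interchange; x∙yz≈y∙xz to ⊗-x∙yz≈y∙xz)
  open ≡-Reasoning

  eval-+ₚ : ∀ x p q → eval x (p +ₚ q) ≡ eval x p ⊕ eval x q
  eval-+ₚ x []      q       = sym (+-identityˡ (eval x q))
  eval-+ₚ x (a ∷ p) []      = sym (+-identityʳ (eval x (a ∷ p)))
  eval-+ₚ x (a ∷ p) (b ∷ q) = begin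
    ι (a + b) ⊕ x ⊗ eval x (p +ₚ q)                 ≡⟨ cong₂ (λ c r → c ⊕ x ⊗ r) (ι-+ a b) (eval-+ₚ x p q) ⟩
    (ι a ⊕ ι b) ⊕ x ⊗ (eval x p ⊕ eval x q)         ≡⟨ cong ((ι a ⊕ ι b) ⊕_) (distribˡ x (eval x p) (eval x q)) ⟩
    (ι a ⊕ ι b) ⊕ (x ⊗ eval x p ⊕ x ⊗ eval x q)     ≡⟨ ⊕-interchange (ι a) (ι b) (x ⊗ eval x p) (x ⊗ eval x q) ⟩
    (ι a ⊕ x ⊗ eval x p) ⊕ (ι b ⊕ x ⊗ eval x q)     ∎

  eval-scaleₚ : ∀ x a p → eval x (scaleₚ a p) ≡ ι a ⊗ eval x p
  eval-scaleₚ x a []      = sym (zeroʳ (ι a))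
  eval-scaleₚ x a (b ∷ p) = begin
    ι (a * b) ⊕ x ⊗ eval x (scaleₚ a p)   ≡⟨ cong₂ (λ c r → c ⊕ x ⊗ r) (ι-* a b) (eval-scaleₚ x a p) ⟩
    ι a ⊗ ι b ⊕ x ⊗ (ι a ⊗ eval x p)      ≡⟨ cong (ι a ⊗ ι b ⊕_) (⊗-x∙yz≈y∙xz x (ι a) (eval x p)) ⟩
    ι a ⊗ ι b ⊕ ι a ⊗ (x ⊗ eval x p)      ≡⟨ distribˡ (ι a) (ι b) (x ⊗ eval x p) ⟨
    ι a ⊗ (ι b ⊕ x ⊗ eval x p)            ∎

  eval-*ₚ : ∀ x p q → eval x (p *ₚ q) ≡ eval x p ⊗ eval x q
  eval-*ₚ x []      q = sym (zeroˡ (eval x q))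
  eval-*ₚ x (a ∷ p) q = begin
    eval x (scaleₚ a q +ₚ (0ℚ ∷ p *ₚ q))                  ≡⟨ eval-+ₚ x (scaleₚ a q) (0ℚ ∷ p *ₚ q) ⟩
    eval x (scaleₚ a q) ⊕ (ι 0ℚ ⊕ x ⊗ eval x (p *ₚ q))    ≡⟨ cong₂ _⊕_ (eval-scaleₚ x a q) (+-identityˡ _) ⟩
    ι a ⊗ eval x q ⊕ x ⊗ eval x (p *ₚ q)                  ≡⟨ cong (λ r → ι a ⊗ eval x q ⊕ x ⊗ r) (eval-*ₚ x p q) ⟩
    ι a ⊗ eval x q ⊕ x ⊗ (eval x p ⊗ eval x q)            ≡⟨ cong (ι a ⊗ eval x q ⊕_) (*-assoc x (eval x p) (eval x q)) ⟨
    ι a ⊗ eval x q ⊕ x ⊗ eval x p ⊗ eval x q              ≡⟨ distribʳ (eval x q) (ι a) (x ⊗ eval x p) ⟨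
    (ι a ⊕ x ⊗ eval x p) ⊗ eval x q                       ∎

  eval-≈ₚ[] : ∀ x p → p ≈ₚ [] → eval x p ≡ ι 0ℚ
  eval-≈ₚ[] x []      p≈0 = refl
  eval-≈ₚ[] x (a ∷ p) p≈0 = begin
    ι a ⊕ x ⊗ eval x p   ≡⟨ cong₂ (λ c r → ι c ⊕ x ⊗ r) (p≈0 0) (eval-≈ₚ[] x p (λ n → p≈0 (suc n))) ⟩
    ι 0ℚ ⊕ x ⊗ ι 0ℚ      ≡⟨ +-identityˡ (x ⊗ ι 0ℚ) ⟩
    x ⊗ ι 0ℚ             ≡⟨ zeroʳ x ⟩
    ι 0ℚ                 ∎

  eval-≈ₚ : ∀ x p q → p ≈ₚ q → eval x p ≡ eval x q
  eval-≈ₚ x []      q       p≈q = sym (eval-≈ₚ[] x q (λ n → sym (p≈q n)))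
  eval-≈ₚ x (a ∷ p) []      p≈q = eval-≈ₚ[] x (a ∷ p) p≈q
  eval-≈ₚ x (a ∷ p) (b ∷ q) p≈q = cong₂ (λ c r → ι c ⊕ x ⊗ r) (p≈q 0) (eval-≈ₚ x p q (λ n → p≈q (suc n)))

  eval-constant : ∀ x c → eval x (c ∷ []) ≡ ι c
  eval-constant x c = trans (cong (ι c ⊕_) (zeroʳ x)) (+-identityʳ (ι c))

  eval-oneₚ : ∀ x → eval x oneₚ ≡ ι 1ℚ
  eval-oneₚ x = eval-constant x 1ℚ

  eval-cubeₚ : ∀ x p → eval x (cubeₚ p) ≡ cube (eval x p)
  eval-cubeₚ x p = trans (eval-*ₚ x (p *ₚ p) p) (cong (_⊗ eval x p) (eval-*ₚ x p p))

  eval-cubeₚ+oneₚ : ∀ x p → eval x (cubeₚ p +ₚ oneₚ) ≡ cube (eval x p) ⊕ ι 1ℚ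
  eval-cubeₚ+oneₚ x p = trans (eval-+ₚ x (cubeₚ p) oneₚ) (cong₂ _⊕_ (eval-cubeₚ x p) (eval-oneₚ x))

  eval-∣ₚ : ∀ x g p → g ∣ₚ p → Σ Carrier λ c → eval x p ≡ eval x g ⊗ c
  eval-∣ₚ x g p (h , gh≈p) = eval x h , trans (eval-≈ₚ x p (g *ₚ h) (λ n → sym (gh≈p n))) (eval-*ₚ x g h)

  eval-division : ∀ x g q l r → g ≈ₚ q *ₚ l +ₚ r → eval x g ≡ eval x q ⊗ eval x l ⊕ eval x r
  eval-division x g q l r g≈ = begin
    eval x g                            ≡⟨ eval-≈ₚ x g (q *ₚ l +ₚ r) g≈ ⟩
    eval x (q *ₚ l +ₚ r)                ≡⟨ eval-+ₚ x (q *ₚ l) r ⟩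
    eval x (q *ₚ l) ⊕ eval x r          ≡⟨ cong (_⊕ eval x r) (eval-*ₚ x q l) ⟩
    eval x q ⊗ eval x l ⊕ eval x r      ∎

  eval-remainder : ∀ x g q l r → g ≈ₚ q *ₚ l +ₚ r → eval x q ≡ ι 0ℚ → eval x g ≡ eval x r
  eval-remainder x g q l r g≈ q[x]≡0 = begin
    eval x g                            ≡⟨ eval-division x g q l r g≈ ⟩
    eval x q ⊗ eval x l ⊕ eval x r      ≡⟨ cong (λ c → c ⊗ eval x l ⊕ eval x r) q[x]≡0 ⟩
    ι 0ℚ ⊗ eval x l ⊕ eval x r          ≡⟨ cong (_⊕ eval x r) (zeroˡ (eval x l)) ⟩
    ι 0ℚ ⊕ eval x r                     ≡⟨ +-identityˡ (eval x r) ⟩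
    eval x r                            ∎

  root-of-divisor : ∀ x g p → g ∣ₚ p → eval x g ≡ ι 0ℚ → eval x p ≡ ι 0ℚ
  root-of-divisor x g p g∣p g[x]≡0 with eval-∣ₚ x g p g∣p
  ... | c , p[x]≡g[x]c = trans p[x]≡g[x]c (trans (cong (_⊗ c) g[x]≡0) (zeroˡ c))

  cube-⊗ : ∀ x y → cube (x ⊗ y) ≡ cube x ⊗ cube y
  cube-⊗ x y = trans (cong (_⊗ (x ⊗ y)) (⊗-interchange x y x y)) (⊗-interchange (x ⊗ x) (y ⊗ y) x y)

  private
    -𝟙 : Carrier
    -𝟙 = ι (- 1ℚ)

    -𝟙⊗-𝟙≡𝟙 : -𝟙 ⊗ -𝟙 ≡ ι 1ℚ
    -𝟙⊗-𝟙≡𝟙 = sym (ι-* (- 1ℚ) (- 1ℚ))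

    x⊕y≡0⇒y≡-𝟙⊗x : ∀ {x y} → x ⊕ y ≡ ι 0ℚ → y ≡ -𝟙 ⊗ x
    x⊕y≡0⇒y≡-𝟙⊗x {x} {y} x⊕y≡0 = begin
      y                      ≡⟨ +-identityʳ y ⟨
      y ⊕ ι 0ℚ               ≡⟨ cong (y ⊕_) (zeroˡ x) ⟨
      y ⊕ ι 0ℚ ⊗ x           ≡⟨ cong (λ c → y ⊕ c ⊗ x) (ι-+ 1ℚ (- 1ℚ)) ⟩
      y ⊕ (ι 1ℚ ⊕ -𝟙) ⊗ x    ≡⟨ cong (y ⊕_) (trans (distribʳ x (ι 1ℚ) -𝟙) (cong (_⊕ -𝟙 ⊗ x) (*-identityˡ x))) ⟩
      y ⊕ (x ⊕ -𝟙 ⊗ x)       ≡⟨ +-assoc y x (-𝟙 ⊗ x) ⟨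
      y ⊕ x ⊕ -𝟙 ⊗ x         ≡⟨ cong (_⊕ -𝟙 ⊗ x) (trans (+-comm y x) x⊕y≡0) ⟩
      ι 0ℚ ⊕ -𝟙 ⊗ x          ≡⟨ +-identityˡ (-𝟙 ⊗ x) ⟩
      -𝟙 ⊗ x                 ∎

  F⊗L⊕R≡0⇒cubeL≡cubeR : ∀ {F L R} → F ⊗ L ⊕ R ≡ ι 0ℚ → cube F ⊕ ι 1ℚ ≡ ι 0ℚ → cube L ≡ cube R
  F⊗L⊕R≡0⇒cubeL≡cubeR {F} {L} {R} FL⊕R≡0 F³⊕1≡0 = begin
    cube L                            ≡⟨ *-identityˡ (cube L) ⟨
    ι 1ℚ ⊗ cube L                     ≡⟨ cong (_⊗ cube L) (x⊕y≡0⇒y≡-𝟙⊗x F³⊕1≡0) ⟩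
    -𝟙 ⊗ cube F ⊗ cube L              ≡⟨ *-assoc -𝟙 (cube F) (cube L) ⟩
    -𝟙 ⊗ (cube F ⊗ cube L)            ≡⟨ cong (_⊗ (cube F ⊗ cube L)) cube[-𝟙]≡-𝟙 ⟨
    cube -𝟙 ⊗ (cube F ⊗ cube L)       ≡⟨ cong (cube -𝟙 ⊗_) (cube-⊗ F L) ⟨
    cube -𝟙 ⊗ cube (F ⊗ L)            ≡⟨ cube-⊗ -𝟙 (F ⊗ L) ⟨
    cube (-𝟙 ⊗ (F ⊗ L))               ≡⟨ cong cube (x⊕y≡0⇒y≡-𝟙⊗x FL⊕R≡0) ⟨
    cube R                            ∎
    where
    cube[-𝟙]≡-𝟙 : cube -𝟙 ≡ -𝟙
    cube[-𝟙]≡-𝟙 = trans (cong (_⊗ -𝟙) -𝟙⊗-𝟙≡𝟙) (*-identityˡ -𝟙)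

-- The algebras ℚ[z]/(z² − r) and ℚ[z]/(z³ + E z² + P z + Q)

≡-isCommutativeSemiring : ∀ {A : Set} {_+_ _*_ : Op₂ A} {0# 1# : A} →
  Associative _≡_ _+_ → Commutative _≡_ _+_ → LeftIdentity _≡_ 0# _+_ →
  Associative _≡_ _*_ → Commutative _≡_ _*_ → LeftIdentity _≡_ 1# _*_ →
  _DistributesOverʳ_ _≡_ _*_ _+_ → LeftZero _≡_ 0# _*_ →
  IsCommutativeSemiring _≡_ _+_ _*_ 0# 1#
≡-isCommutativeSemiring {_+_ = _+_} {_*_} +-assoc +-comm +-identityˡ *-assoc *-comm *-identityˡ distribʳ zeroˡ =
  isCommutativeSemiringˡ record
    { +-isCommutativeMonoid = monoid +-assoc +-comm +-identityˡ
    ; *-isCommutativeMonoid = monoid *-assoc *-comm *-identityˡ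
    ; distribʳ = distribʳ
    ; zeroˡ = zeroˡ
    }
  where
  monoid : ∀ {_∙_ ε} → Associative _≡_ _∙_ → Commutative _≡_ _∙_ → LeftIdentity _≡_ ε _∙_ → _
  monoid {_∙_} assoc comm identityˡ = isCommutativeMonoidˡ record
    { isSemigroup = record { isMagma = record { isEquivalence = isEquivalence ; ∙-cong = cong₂ _∙_ } ; assoc = assoc }
    ; identityˡ = identityˡ
    ; comm = comm
    }

infix 5 ⟨_,_⟩ ⟪_,_,_⟫

-- Data types rather than products, so that their operations compute coordinates the ring solver can see.

data ℚ² : Set where
  ⟨_,_⟩ : ℚ → ℚ → ℚ²

data ℚ³ : Set where
  ⟪_,_,_⟫ : ℚ → ℚ → ℚ → ℚ³

⟨,⟩-cong : ∀ {a b c d} → a ≡ c → b ≡ d → ⟨ a , b ⟩ ≡ ⟨ c , d ⟩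
⟨,⟩-cong refl refl = refl

⟪,,⟫-cong : ∀ {a b c d e f} → a ≡ d → b ≡ e → c ≡ f → ⟪ a , b , c ⟫ ≡ ⟪ d , e , f ⟫
⟪,,⟫-cong refl refl refl = refl

⟨,⟩-injective : ∀ {a b c d} → ⟨ a , b ⟩ ≡ ⟨ c , d ⟩ → a ≡ c × b ≡ d
⟨,⟩-injective refl = refl , refl

⟪,,⟫-injective : ∀ {a b c d e f} → ⟪ a , b , c ⟫ ≡ ⟪ d , e , f ⟫ → a ≡ d × b ≡ e × c ≡ f
⟪,,⟫-injective refl = refl , refl , refl

-- ℚ[z]/(z² − r), with ⟨ a , b ⟩ standing for a + b z
module Quadratic (r : ℚ) where
  infixl 6 _⊕_
  infixl 7 _⊗_

  _⊕_ _⊗_ : ℚ² → ℚ² → ℚ²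
  ⟨ a , b ⟩ ⊕ ⟨ c , d ⟩ = ⟨ a + c , b + d ⟩
  ⟨ a , b ⟩ ⊗ ⟨ c , d ⟩ = ⟨ a * c + r * (b * d) , a * d + b * c ⟩

  ι : ℚ → ℚ²
  ι a = ⟨ a , 0ℚ ⟩

  ⊕-assoc : Associative _≡_ _⊕_
  ⊕-assoc ⟨ a , b ⟩ ⟨ c , d ⟩ ⟨ e , f ⟩ = ⟨,⟩-cong (ℚ.+-assoc a c e) (ℚ.+-assoc b d f)

  ⊕-comm : Commutative _≡_ _⊕_
  ⊕-comm ⟨ a , b ⟩ ⟨ c , d ⟩ = ⟨,⟩-cong (ℚ.+-comm a c) (ℚ.+-comm b d)

  ⊕-identityˡ : LeftIdentity _≡_ (ι 0ℚ) _⊕_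
  ⊕-identityˡ ⟨ a , b ⟩ = ⟨,⟩-cong (ℚ.+-identityˡ a) (ℚ.+-identityˡ b)

  ⊗-assoc : Associative _≡_ _⊗_
  ⊗-assoc ⟨ a , b ⟩ ⟨ c , d ⟩ ⟨ e , f ⟩ = ⟨,⟩-cong (solve vars ℚ-ring) (solve vars ℚ-ring)
    where vars = a ∷ b ∷ c ∷ d ∷ e ∷ f ∷ r ∷ []

  ⊗-comm : Commutative _≡_ _⊗_
  ⊗-comm ⟨ a , b ⟩ ⟨ c , d ⟩ = ⟨,⟩-cong (solve vars ℚ-ring) (solve vars ℚ-ring)
    where vars = a ∷ b ∷ c ∷ d ∷ r ∷ []

  ⊗-identityˡ : LeftIdentity _≡_ (ι 1ℚ) _⊗_
  ⊗-identityˡ ⟨ a , b ⟩ = ⟨,⟩-cong (solve (a ∷ b ∷ r ∷ []) ℚ-ring) (solve (a ∷ b ∷ []) ℚ-ring)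

  distribʳ : _DistributesOverʳ_ _≡_ _⊗_ _⊕_
  distribʳ ⟨ a , b ⟩ ⟨ c , d ⟩ ⟨ e , f ⟩ = ⟨,⟩-cong (solve vars ℚ-ring) (solve vars ℚ-ring)
    where vars = a ∷ b ∷ c ∷ d ∷ e ∷ f ∷ r ∷ []

  zeroˡ : LeftZero _≡_ (ι 0ℚ) _⊗_
  zeroˡ ⟨ a , b ⟩ = ⟨,⟩-cong (solve (a ∷ b ∷ r ∷ []) ℚ-ring) (solve (a ∷ b ∷ []) ℚ-ring)

  algebra : ℚ-Algebra
  algebra = record
    { Carrier = ℚ²
    ; _⊕_ = _⊕_
    ; _⊗_ = _⊗_
    ; ι = ι
    ; isCommutativeSemiring =
        ≡-isCommutativeSemiring ⊕-assoc ⊕-comm ⊕-identityˡ ⊗-assoc ⊗-comm ⊗-identityˡ distribʳ zeroˡ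
    ; ι-+ = λ a b → refl
    ; ι-* = λ a b → ⟨,⟩-cong (solve (a ∷ b ∷ r ∷ []) ℚ-ring) (solve (a ∷ b ∷ []) ℚ-ring)
    }

-- ℚ[z]/(z³ + E z² + P z + Q), with ⟪ a , b , c ⟫ standing for a + b z + c z²
module Cubic (E P Q : ℚ) where
  infixl 6 _⊕_
  infixl 7 _⊗_

  -- m₀ + m₁ z + m₂ z² + m₃ z³ + m₄ z⁴ reduced modulo z³ + E z² + P z + Q
  reduce-mod : ℚ → ℚ → ℚ → ℚ → ℚ → ℚ³
  reduce-mod m₀ m₁ m₂ m₃ m₄ =
    ⟪ m₀ - Q * m₃ + E * Q * m₄ , m₁ - P * m₃ + (E * P - Q) * m₄ , m₂ - E * m₃ + (E * E - P) * m₄ ⟫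

  _⊕_ _⊗_ : ℚ³ → ℚ³ → ℚ³
  ⟪ a₀ , a₁ , a₂ ⟫ ⊕ ⟪ b₀ , b₁ , b₂ ⟫ = ⟪ a₀ + b₀ , a₁ + b₁ , a₂ + b₂ ⟫
  ⟪ a₀ , a₁ , a₂ ⟫ ⊗ ⟪ b₀ , b₁ , b₂ ⟫ =
    reduce-mod (a₀ * b₀) (a₀ * b₁ + a₁ * b₀) (a₀ * b₂ + a₁ * b₁ + a₂ * b₀) (a₁ * b₂ + a₂ * b₁) (a₂ * b₂)

  ι : ℚ → ℚ³
  ι a = ⟪ a , 0ℚ , 0ℚ ⟫

  ⊕-assoc : Associative _≡_ _⊕_
  ⊕-assoc ⟪ a₀ , a₁ , a₂ ⟫ ⟪ b₀ , b₁ , b₂ ⟫ ⟪ c₀ , c₁ , c₂ ⟫ =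
    ⟪,,⟫-cong (ℚ.+-assoc a₀ b₀ c₀) (ℚ.+-assoc a₁ b₁ c₁) (ℚ.+-assoc a₂ b₂ c₂)

  ⊕-comm : Commutative _≡_ _⊕_
  ⊕-comm ⟪ a₀ , a₁ , a₂ ⟫ ⟪ b₀ , b₁ , b₂ ⟫ = ⟪,,⟫-cong (ℚ.+-comm a₀ b₀) (ℚ.+-comm a₁ b₁) (ℚ.+-comm a₂ b₂)

  ⊕-identityˡ : LeftIdentity _≡_ (ι 0ℚ) _⊕_
  ⊕-identityˡ ⟪ a₀ , a₁ , a₂ ⟫ = ⟪,,⟫-cong (ℚ.+-identityˡ a₀) (ℚ.+-identityˡ a₁) (ℚ.+-identityˡ a₂)

  ⊗-assoc : Associative _≡_ _⊗_
  ⊗-assoc ⟪ a₀ , a₁ , a₂ ⟫ ⟪ b₀ , b₁ , b₂ ⟫ ⟪ c₀ , c₁ , c₂ ⟫ = ⟪,,⟫-cong (solve vars ℚ-ring) (solve vars ℚ-ring) (solve vars ℚ-ring)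
    where vars = a₀ ∷ a₁ ∷ a₂ ∷ b₀ ∷ b₁ ∷ b₂ ∷ c₀ ∷ c₁ ∷ c₂ ∷ E ∷ P ∷ Q ∷ []

  ⊗-comm : Commutative _≡_ _⊗_
  ⊗-comm ⟪ a₀ , a₁ , a₂ ⟫ ⟪ b₀ , b₁ , b₂ ⟫ = ⟪,,⟫-cong (solve vars ℚ-ring) (solve vars ℚ-ring) (solve vars ℚ-ring)
    where vars = a₀ ∷ a₁ ∷ a₂ ∷ b₀ ∷ b₁ ∷ b₂ ∷ E ∷ P ∷ Q ∷ []

  ⊗-identityˡ : LeftIdentity _≡_ (ι 1ℚ) _⊗_
  ⊗-identityˡ ⟪ a₀ , a₁ , a₂ ⟫ = ⟪,,⟫-cong (solve vars ℚ-ring) (solve vars ℚ-ring) (solve vars ℚ-ring)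
    where vars = a₀ ∷ a₁ ∷ a₂ ∷ E ∷ P ∷ Q ∷ []

  distribʳ : _DistributesOverʳ_ _≡_ _⊗_ _⊕_
  distribʳ ⟪ a₀ , a₁ , a₂ ⟫ ⟪ b₀ , b₁ , b₂ ⟫ ⟪ c₀ , c₁ , c₂ ⟫ = ⟪,,⟫-cong (solve vars ℚ-ring) (solve vars ℚ-ring) (solve vars ℚ-ring)
    where vars = a₀ ∷ a₁ ∷ a₂ ∷ b₀ ∷ b₁ ∷ b₂ ∷ c₀ ∷ c₁ ∷ c₂ ∷ E ∷ P ∷ Q ∷ []

  zeroˡ : LeftZero _≡_ (ι 0ℚ) _⊗_
  zeroˡ ⟪ a₀ , a₁ , a₂ ⟫ = ⟪,,⟫-cong (solve vars ℚ-ring) (solve vars ℚ-ring) (solve vars ℚ-ring)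
    where vars = a₀ ∷ a₁ ∷ a₂ ∷ E ∷ P ∷ Q ∷ []

  algebra : ℚ-Algebra
  algebra = record
    { Carrier = ℚ³
    ; _⊕_ = _⊕_
    ; _⊗_ = _⊗_
    ; ι = ι
    ; isCommutativeSemiring =
        ≡-isCommutativeSemiring ⊕-assoc ⊕-comm ⊕-identityˡ ⊗-assoc ⊗-comm ⊗-identityˡ distribʳ zeroˡ
    ; ι-+ = λ a b → refl
    ; ι-* = λ a b → let vars = a ∷ b ∷ E ∷ P ∷ Q ∷ [] in
        ⟪,,⟫-cong (solve vars ℚ-ring) (solve vars ℚ-ring) (solve vars ℚ-ring)
    }

-- Normal form

-- a ((t + σ)² − s)
quadraticₚ : ℚ → ℚ → ℚ → Poly
quadraticₚ a σ s = a * (σ * σ - s) ∷ 2 * a * σ ∷ a ∷ []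

-- k (t + σ) + c
linearₚ : ℚ → ℚ → ℚ → Poly
linearₚ σ k c = linₚ k (k * σ + c)

record NormalForm (f g : Poly) : Set where
  constructor normalForm
  field
    a σ s l y u v : ℚ
    a≢0 : a ≢ 0ℚ
    l≢0 : l ≢ 0ℚ
    f≈ : f ≈ₚ quadraticₚ a σ s
    g≈ : g ≈ₚ quadraticₚ a σ s *ₚ linearₚ σ l y +ₚ linearₚ σ u v

complete-square : ∀ {c b a i} → a * i ≡ 1ℚ → c ∷ b ∷ a ∷ [] ≋ quadraticₚ a (b * i * ½) (b * i * ½ * (b * i * ½) - c * i)
complete-square {c} {b} {a} {i} ai≡1 =
  combine₁ ai≡1 (- c) (solve (c ∷ b ∷ a ∷ i ∷ []) ℚ-ring) ∷ combine₁ ai≡1 (- b) (solve (c ∷ b ∷ a ∷ i ∷ []) ℚ-ring) ∷ refl ∷ []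

divide : ∀ {a σ s i q p e d} → a * i ≡ 1ℚ →
  let l = d * i
      y = e * i - 3 * σ * l
      u = p - (3 * a * σ * σ * l + 2 * a * σ * y - a * s * l)
      v = q - (a * σ * σ * σ * l + a * σ * σ * y + σ * (u - a * s * l) - a * s * y)
  in q ∷ p ∷ e ∷ d ∷ [] ≋ quadraticₚ a σ s *ₚ linearₚ σ l y +ₚ linearₚ σ u v
divide {a} {σ} {s} {i} {q} {p} {e} {d} ai≡1 =
  solve vars ℚ-ring ∷ solve vars ℚ-ring ∷ combine₁ ai≡1 (- e) (solve vars ℚ-ring) ∷ combine₁ ai≡1 (- d) (solve vars ℚ-ring) ∷ []
  where vars = a ∷ σ ∷ s ∷ i ∷ q ∷ p ∷ e ∷ d ∷ []

normal-form : ∀ {f g} → HasDegree f 2 → HasDegree g 3 → NormalForm f g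
normal-form {f} {g} f² g³ = normalForm a σ s (d * i) y u v a≢0 (*-≢0 (proj₁ g³) i≢0)
  (begin
    f                                                     ≈⟨ HasDegree⇒≈ₚ-coefficients {f} f² ⟩
    c ∷ b ∷ a ∷ []                                        ≈⟨ ≋⇒≈ₚ (complete-square {c} {b} {a} {i} (*-inverseʳ a)) ⟩
    quadraticₚ a σ s                                      ∎)
  (begin
    g                                                     ≈⟨ HasDegree⇒≈ₚ-coefficients {g} g³ ⟩
    q ∷ p ∷ e ∷ d ∷ []                                    ≈⟨ ≋⇒≈ₚ (divide {a} {σ} {s} {i} {q} {p} {e} {d} (*-inverseʳ a)) ⟩
    quadraticₚ a σ s *ₚ linearₚ σ (d * i) y +ₚ linearₚ σ u v ∎)
  where
  open ≈ₚ-Reasoning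
  c = coeff f 0
  b = coeff f 1
  a = coeff f 2
  q = coeff g 0
  p = coeff g 1
  e = coeff g 2
  d = coeff g 3
  a≢0 = proj₁ f²
  instance _ = ≢-nonZero a≢0
  i = 1/ a
  i≢0 : i ≢ 0ℚ
  i≢0 i≡0 = 1≢0 (trans (sym (*-inverseʳ a)) (trans (cong (a *_) i≡0) (ℚ.*-zeroʳ a)))
  σ = b * i * ½
  s = σ * σ - c * i
  y = e * i - 3 * σ * (d * i)
  u = p - (3 * a * σ * σ * (d * i) + 2 * a * σ * y - a * s * (d * i))
  v = q - (a * σ * σ * σ * (d * i) + a * σ * σ * y + σ * (u - a * s * (d * i)) - a * s * y)

module _ (r σ w : ℚ) where
  open ℚ-Algebra (Quadratic.algebra r)
  open Evaluation (Quadratic.algebra r)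

  eval-quadraticₚ-ℚ² : ∀ a s → eval ⟨ w - σ , 1ℚ ⟩ (quadraticₚ a σ s) ≡ ⟨ a * (w * w + r - s) , 2 * a * w ⟩
  eval-quadraticₚ-ℚ² a s = trans (cong (λ e → ι (a * (σ * σ - s)) ⊕ x ⊗ (ι (2 * a * σ) ⊕ x ⊗ e)) (eval-constant x a))
    (⟨,⟩-cong (solve (a ∷ σ ∷ s ∷ w ∷ r ∷ []) ℚ-ring) (solve (a ∷ σ ∷ s ∷ w ∷ r ∷ []) ℚ-ring))
    where x = ⟨ w - σ , 1ℚ ⟩

  eval-linearₚ-ℚ² : ∀ k c → eval ⟨ w - σ , 1ℚ ⟩ (linearₚ σ k c) ≡ ⟨ k * w + c , k ⟩
  eval-linearₚ-ℚ² k c = trans (cong (λ e → ι (k * σ + c) ⊕ x ⊗ e) (eval-constant x k))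
    (⟨,⟩-cong (solve (k ∷ c ∷ σ ∷ w ∷ r ∷ []) ℚ-ring) (solve (k ∷ c ∷ σ ∷ w ∷ r ∷ []) ℚ-ring))
    where x = ⟨ w - σ , 1ℚ ⟩

module _ (E P Q σ : ℚ) where
  open ℚ-Algebra (Cubic.algebra E P Q)
  open Evaluation (Cubic.algebra E P Q)

  horner-ℚ³ : ∀ c₀ c₁ c₂ → ι c₀ ⊕ ⟪ - σ , 1ℚ , 0ℚ ⟫ ⊗ (ι c₁ ⊕ ⟪ - σ , 1ℚ , 0ℚ ⟫ ⊗ ι c₂) ≡ ⟪ c₀ - σ * c₁ + σ * σ * c₂ , c₁ - 2 * σ * c₂ , c₂ ⟫
  horner-ℚ³ c₀ c₁ c₂ = ⟪,,⟫-cong (solve vars ℚ-ring) (solve vars ℚ-ring) (solve vars ℚ-ring)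
    where vars = σ ∷ c₀ ∷ c₁ ∷ c₂ ∷ E ∷ P ∷ Q ∷ []

  eval-quadraticₚ-ℚ³ : ∀ a s → eval ⟪ - σ , 1ℚ , 0ℚ ⟫ (quadraticₚ a σ s) ≡ ⟪ - (a * s) , 0ℚ , a ⟫
  eval-quadraticₚ-ℚ³ a s = trans (cong (λ e → ι (a * (σ * σ - s)) ⊕ x ⊗ (ι (2 * a * σ) ⊕ x ⊗ e)) (eval-constant x a))
    (trans (horner-ℚ³ (a * (σ * σ - s)) (2 * a * σ) a) (⟪,,⟫-cong (solve (a ∷ σ ∷ s ∷ []) ℚ-ring) (solve (a ∷ σ ∷ []) ℚ-ring) refl))
    where x = ⟪ - σ , 1ℚ , 0ℚ ⟫

  eval-linearₚ-ℚ³ : ∀ k c → eval ⟪ - σ , 1ℚ , 0ℚ ⟫ (linearₚ σ k c) ≡ ⟪ c , k , 0ℚ ⟫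
  eval-linearₚ-ℚ³ k c = trans (cong (λ e → ι (k * σ + c) ⊕ x ⊗ e) (eval-constant x k))
    (⟪,,⟫-cong (solve vars ℚ-ring) (solve vars ℚ-ring) (solve vars ℚ-ring))
    where
    x = ⟪ - σ , 1ℚ , 0ℚ ⟫
    vars = k ∷ c ∷ σ ∷ E ∷ P ∷ Q ∷ []

  cube-ℚ³ : ∀ c k → cube ⟪ c , k , 0ℚ ⟫ ≡ ⟪ c * c * c - k * k * k * Q , 3 * c * c * k - k * k * k * P , 3 * c * k * k - k * k * k * E ⟫
  cube-ℚ³ c k = ⟪,,⟫-cong (solve vars ℚ-ring) (solve vars ℚ-ring) (solve vars ℚ-ring)
    where vars = c ∷ k ∷ E ∷ P ∷ Q ∷ []

-- At t = √s − σ, f vanishes and g takes the value v + u √s, whose cube must therefore be −1.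
f∣g³+1⇒R[√s]³≡-1 : ∀ {f g} (N : NormalForm f g) → f ∣ₚ cubeₚ g +ₚ oneₚ → let open NormalForm N in
  (v * v * v + 3 * v * (u * u * s) + 1ℚ ≡ 0ℚ) × (u * (3 * v * v + u * u * s) ≡ 0ℚ)
f∣g³+1⇒R[√s]³≡-1 {f} {g} (normalForm a σ s l y u v _ _ f≈ g≈) f∣g³+1 = ⟨,⟩-injective (begin
  ⟨ v * v * v + 3 * v * (u * u * s) + 1ℚ , u * (3 * v * v + u * u * s) ⟩
    ≡⟨ ⟨,⟩-cong (solve (u ∷ v ∷ s ∷ []) ℚ-ring) (solve (u ∷ v ∷ s ∷ []) ℚ-ring) ⟩
  cube ⟨ v , u ⟩ ⊕ ι 1ℚ       ≡⟨ cong (λ c → cube c ⊕ ι 1ℚ) g[x]≡⟨v,u⟩ ⟨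
  cube (eval x g) ⊕ ι 1ℚ      ≡⟨ eval-cubeₚ+oneₚ x g ⟨
  eval x (cubeₚ g +ₚ oneₚ)    ≡⟨ root-of-divisor x f (cubeₚ g +ₚ oneₚ) f∣g³+1 f[x]≡0 ⟩
  ι 0ℚ                        ∎)
  where
  open ℚ-Algebra (Quadratic.algebra s)
  open Evaluation (Quadratic.algebra s)
  open ≡-Reasoning
  x = ⟨ 0ℚ - σ , 1ℚ ⟩
  q[x]≡0 : eval x (quadraticₚ a σ s) ≡ ι 0ℚ
  q[x]≡0 = trans (eval-quadraticₚ-ℚ² s σ 0ℚ a s) (⟨,⟩-cong (solve (a ∷ s ∷ []) ℚ-ring) (solve (a ∷ []) ℚ-ring))
  f[x]≡0 : eval x f ≡ ι 0ℚ
  f[x]≡0 = trans (eval-≈ₚ x f (quadraticₚ a σ s) f≈) q[x]≡0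
  g[x]≡⟨v,u⟩ : eval x g ≡ ⟨ v , u ⟩
  g[x]≡⟨v,u⟩ = begin
    eval x g                    ≡⟨ eval-remainder x g (quadraticₚ a σ s) (linearₚ σ l y) (linearₚ σ u v) g≈ q[x]≡0 ⟩
    eval x (linearₚ σ u v)      ≡⟨ eval-linearₚ-ℚ² s σ 0ℚ u v ⟩
    ⟨ u * 0ℚ + v , u ⟩          ≡⟨ ⟨,⟩-cong (solve (u ∷ v ∷ []) ℚ-ring) refl ⟩
    ⟨ v , u ⟩                   ∎

-- The hypotheses say that z³ + E z² + P z + Q is g/(a l) in the variable z = t + σ. Modulo g we have
-- f L = −R and f³ = −1, hence L³ = R³.
L³≡R³-modulo-g : ∀ {f g a σ s l y u v E P Q} →
  a * l * E ≡ a * y → a * l * P ≡ u - a * s * l → a * l * Q ≡ v - a * s * y →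
  f ≈ₚ quadraticₚ a σ s → g ≈ₚ quadraticₚ a σ s *ₚ linearₚ σ l y +ₚ linearₚ σ u v → g ∣ₚ cubeₚ f +ₚ oneₚ →
  ⟪ y * y * y - l * l * l * Q , 3 * y * y * l - l * l * l * P , 3 * y * l * l - l * l * l * E ⟫ ≡
  ⟪ v * v * v - u * u * u * Q , 3 * v * v * u - u * u * u * P , 3 * v * u * u - u * u * u * E ⟫
L³≡R³-modulo-g {f} {g} {a} {σ} {s} {l} {y} {u} {v} {E} {P} {Q} alE alP alQ f≈ g≈ g∣f³+1 = begin
  ⟪ y * y * y - l * l * l * Q , 3 * y * y * l - l * l * l * P , 3 * y * l * l - l * l * l * E ⟫ ≡⟨ cube-ℚ³ E P Q σ y l ⟨
  cube L                                                                                      ≡⟨ F⊗L⊕R≡0⇒cubeL≡cubeR {F} {L} {R} FL⊕R≡0 F³⊕1≡0 ⟩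
  cube R                                                                                      ≡⟨ cube-ℚ³ E P Q σ v u ⟩
  ⟪ v * v * v - u * u * u * Q , 3 * v * v * u - u * u * u * P , 3 * v * u * u - u * u * u * E ⟫ ∎
  where
  open ℚ-Algebra (Cubic.algebra E P Q)
  open Evaluation (Cubic.algebra E P Q)
  open ≡-Reasoning
  x = ⟪ - σ , 1ℚ , 0ℚ ⟫
  F = ⟪ - (a * s) , 0ℚ , a ⟫
  L = ⟪ y , l , 0ℚ ⟫
  R = ⟪ v , u , 0ℚ ⟫
  FL⊕R≡0 : F ⊗ L ⊕ R ≡ ι 0ℚ
  FL⊕R≡0 = ⟪,,⟫-cong (combine₁ alQ (- 1ℚ) (solve vars ℚ-ring)) (combine₁ alP (- 1ℚ) (solve vars ℚ-ring))
                     (combine₁ alE (- 1ℚ) (solve vars ℚ-ring))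
    where vars = a ∷ s ∷ l ∷ y ∷ u ∷ v ∷ E ∷ P ∷ Q ∷ []
  f[x]≡F : eval x f ≡ F
  f[x]≡F = trans (eval-≈ₚ x f (quadraticₚ a σ s) f≈) (eval-quadraticₚ-ℚ³ E P Q σ a s)
  g[x]≡0 : eval x g ≡ ι 0ℚ
  g[x]≡0 = begin
    eval x g
      ≡⟨ eval-division x g (quadraticₚ a σ s) (linearₚ σ l y) (linearₚ σ u v) g≈ ⟩
    eval x (quadraticₚ a σ s) ⊗ eval x (linearₚ σ l y) ⊕ eval x (linearₚ σ u v)
      ≡⟨ cong₂ (λ F′ L′ → F′ ⊗ L′ ⊕ eval x (linearₚ σ u v)) {eval x (quadraticₚ a σ s)} {F} {eval x (linearₚ σ l y)} {L}
           (eval-quadraticₚ-ℚ³ E P Q σ a s) (eval-linearₚ-ℚ³ E P Q σ l y) ⟩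
    F ⊗ L ⊕ eval x (linearₚ σ u v)
      ≡⟨ cong (F ⊗ L ⊕_) {eval x (linearₚ σ u v)} {R} (eval-linearₚ-ℚ³ E P Q σ u v) ⟩
    F ⊗ L ⊕ R
      ≡⟨ FL⊕R≡0 ⟩
    ι 0ℚ ∎
  F³⊕1≡0 : cube F ⊕ ι 1ℚ ≡ ι 0ℚ
  F³⊕1≡0 = begin
    cube F ⊕ ι 1ℚ               ≡⟨ cong (λ F′ → cube F′ ⊕ ι 1ℚ) {eval x f} {F} f[x]≡F ⟨
    cube (eval x f) ⊕ ι 1ℚ      ≡⟨ eval-cubeₚ+oneₚ x f ⟨
    eval x (cubeₚ f +ₚ oneₚ)    ≡⟨ root-of-divisor x g (cubeₚ f +ₚ oneₚ) g∣f³+1 g[x]≡0 ⟩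
    ι 0ℚ                        ∎

L³≡R³⇒relations : ∀ {a s l y u v E P Q} → a ≢ 0ℚ →
  a * l * E ≡ a * y → a * l * P ≡ u - a * s * l → a * l * Q ≡ v - a * s * y →
  (y * y * y - l * l * l * Q ≡ v * v * v - u * u * u * Q) ×
  (3 * y * y * l - l * l * l * P ≡ 3 * v * v * u - u * u * u * P) ×
  (3 * y * l * l - l * l * l * E ≡ 3 * v * u * u - u * u * u * E) →
  (a * l * (y * y * y - v * v * v) ≡ (l * l * l - u * u * u) * (v - a * s * y)) ×
  (3 * a * l * (l * y * y - u * v * v) ≡ (l * l * l - u * u * u) * (u - a * s * l)) ×
  ((2 * (l * l * l) + u * u * u) * y ≡ 3 * l * (u * u) * v)
L³≡R³⇒relations {a} {s} {l} {y} {u} {v} {E} {P} {Q} a≢0 alE alP alQ (K₀ , K₁ , K₂) =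
  combine₂ K₀ alQ (a * l) (l * l * l - u * u * u) (solve vars ℚ-ring) ,
  combine₂ K₁ alP (a * l) (l * l * l - u * u * u) (solve vars ℚ-ring) ,
  x-y≡0⇒x≡y (x*y≡0⇒y≡0 a≢0 (combine₂ K₂ alE (a * l) (l * l * l - u * u * u) (solve vars ℚ-ring)))
  where vars = a ∷ s ∷ l ∷ y ∷ u ∷ v ∷ E ∷ P ∷ Q ∷ []

g∣f³+1⇒relations : ∀ {f g} (N : NormalForm f g) → g ∣ₚ cubeₚ f +ₚ oneₚ → let open NormalForm N in
  (a * l * (y * y * y - v * v * v) ≡ (l * l * l - u * u * u) * (v - a * s * y)) ×
  (3 * a * l * (l * y * y - u * v * v) ≡ (l * l * l - u * u * u) * (u - a * s * l)) ×
  ((2 * (l * l * l) + u * u * u) * y ≡ 3 * l * (u * u) * v)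
g∣f³+1⇒relations {f} {g} (normalForm a σ s l y u v a≢0 l≢0 f≈ g≈) g∣f³+1 =
  L³≡R³⇒relations a≢0 alE alP alQ (⟪,,⟫-injective (L³≡R³-modulo-g {f} {g} {a} {σ} {s} alE alP alQ f≈ g≈ g∣f³+1))
  where
  instance
    _ = ≢-nonZero l≢0
    _ = ≢-nonZero (*-≢0 a≢0 l≢0)
  alE : a * l * (y * 1/ l) ≡ a * y
  alE = trans (ℚ.*-assoc a l (y * 1/ l)) (cong (a *_) (cancel-inverse {l} {1/ l} y (*-inverseʳ l)))
  alP : a * l * ((u - a * s * l) * 1/ (a * l)) ≡ u - a * s * l
  alP = cancel-inverse {a * l} {1/ (a * l)} (u - a * s * l) (*-inverseʳ (a * l))
  alQ : a * l * ((v - a * s * y) * 1/ (a * l)) ≡ v - a * s * y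
  alQ = cancel-inverse {a * l} {1/ (a * l)} (v - a * s * y) (*-inverseʳ (a * l))

module _ where
  open ℚ-Algebra (Quadratic.algebra 0ℚ)

  cube⊕1-ℚ[ε] : ∀ F₀ F₁ → cube ⟨ F₀ , F₁ ⟩ ⊕ ι 1ℚ ≡ ⟨ F₀ * F₀ * F₀ + 1ℚ , 3 * F₀ * F₀ * F₁ ⟩
  cube⊕1-ℚ[ε] F₀ F₁ = ⟨,⟩-cong (solve (F₀ ∷ F₁ ∷ []) ℚ-ring) (solve (F₀ ∷ F₁ ∷ []) ℚ-ring)

  ε-multiple-ℚ[ε] : ∀ G c₀ c₁ → ⟨ 0ℚ , G ⟩ ⊗ ⟨ c₀ , c₁ ⟩ ≡ ⟨ 0ℚ , G * c₀ ⟩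
  ε-multiple-ℚ[ε] G c₀ c₁ = ⟨,⟩-cong (solve (G ∷ c₀ ∷ c₁ ∷ []) ℚ-ring) (solve (G ∷ c₀ ∷ c₁ ∷ []) ℚ-ring)

  F⊗ε⊕ε-ℚ[ε] : ∀ F₀ F₁ u → ⟨ F₀ , F₁ ⟩ ⊗ ⟨ 0ℚ , u ⟩ ⊕ ⟨ 0ℚ , u ⟩ ≡ ⟨ 0ℚ , (F₀ + 1ℚ) * u ⟩
  F⊗ε⊕ε-ℚ[ε] F₀ F₁ u = ⟨,⟩-cong (solve (F₀ ∷ F₁ ∷ u ∷ []) ℚ-ring) (solve (F₀ ∷ F₁ ∷ u ∷ []) ℚ-ring)

double-root : ∀ F₀ F₁ G → F₀ * F₀ * F₀ + 1ℚ ≡ 0ℚ → 3 * F₀ * F₀ * F₁ ≡ (F₀ + 1ℚ) * G → F₁ ≡ 0ℚ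
double-root F₀ F₁ G F₀³+1≡0 eq = x*y≡0⇒y≡0 {3} (λ ()) (combine₂ eq F₀≡-1 1ℚ (G - 3 * F₁ * (F₀ - 1ℚ)) (solve (F₀ ∷ F₁ ∷ G ∷ []) ℚ-ring))
  where
  F₀≡-1 : F₀ ≡ - 1ℚ
  F₀≡-1 = cube-injective (combine₁ F₀³+1≡0 1ℚ (solve (F₀ ∷ []) ℚ-ring))

-- When g = (f + 1)(u x + v), the root w of u x + v is a double root of f³ + 1, so f′(w) = 0, i.e. w = 0; in the dual
-- numbers ℚ[ε]/(ε²) this reads f(w + ε)³ + 1 = (f(w) + 1) u ε c.
double-root-at : ∀ {f g a σ s u v w} → a ≢ 0ℚ → u * w + v ≡ 0ℚ →
  f ≈ₚ quadraticₚ a σ s → g ≈ₚ quadraticₚ a σ s *ₚ linearₚ σ u v +ₚ linearₚ σ u v → g ∣ₚ cubeₚ f +ₚ oneₚ → v ≡ 0ℚ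
double-root-at {f} {g} {a} {σ} {s} {u} {v} {w} a≢0 uw+v≡0 f≈ g≈ g∣f³+1 =
  combine₂ uw+v≡0 w≡0 1ℚ (- u) (solve (u ∷ v ∷ w ∷ []) ℚ-ring)
  where
  open ℚ-Algebra (Quadratic.algebra 0ℚ)
  open Evaluation (Quadratic.algebra 0ℚ)
  x = ⟨ w - σ , 1ℚ ⟩
  F₀ = a * (w * w + 0ℚ - s)
  F₁ = 2 * a * w
  q[x]≡F : eval x (quadraticₚ a σ s) ≡ ⟨ F₀ , F₁ ⟩
  q[x]≡F = eval-quadraticₚ-ℚ² 0ℚ σ w a s
  r[x]≡ε : eval x (linearₚ σ u v) ≡ ⟨ 0ℚ , u ⟩
  r[x]≡ε = trans (eval-linearₚ-ℚ² 0ℚ σ w u v) (cong (λ c → ⟨ c , u ⟩) {u * w + v} {0ℚ} uw+v≡0)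
  g[x]≡ : eval x g ≡ ⟨ 0ℚ , (F₀ + 1ℚ) * u ⟩
  g[x]≡ = begin
    eval x g
      ≡⟨ eval-division x g (quadraticₚ a σ s) (linearₚ σ u v) (linearₚ σ u v) g≈ ⟩
    eval x (quadraticₚ a σ s) ⊗ eval x (linearₚ σ u v) ⊕ eval x (linearₚ σ u v)
      ≡⟨ cong₂ (λ F R → F ⊗ R ⊕ R) {eval x (quadraticₚ a σ s)} {⟨ F₀ , F₁ ⟩} {eval x (linearₚ σ u v)} {⟨ 0ℚ , u ⟩}
           q[x]≡F r[x]≡ε ⟩
    ⟨ F₀ , F₁ ⟩ ⊗ ⟨ 0ℚ , u ⟩ ⊕ ⟨ 0ℚ , u ⟩
      ≡⟨ F⊗ε⊕ε-ℚ[ε] F₀ F₁ u ⟩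
    ⟨ 0ℚ , (F₀ + 1ℚ) * u ⟩ ∎
    where open ≡-Reasoning
  f[x]≡F : eval x f ≡ ⟨ F₀ , F₁ ⟩
  f[x]≡F = trans (eval-≈ₚ x f (quadraticₚ a σ s) f≈) q[x]≡F
  F₁≡0 : ∀ c → eval x (cubeₚ f +ₚ oneₚ) ≡ eval x g ⊗ c → F₁ ≡ 0ℚ
  F₁≡0 ⟨ c₀ , c₁ ⟩ f³+1[x]≡g[x]c =
    double-root F₀ F₁ (u * c₀) (proj₁ components) (trans (proj₂ components) (ℚ.*-assoc (F₀ + 1ℚ) u c₀))
    where
    open ≡-Reasoning
    components : (F₀ * F₀ * F₀ + 1ℚ ≡ 0ℚ) × (3 * F₀ * F₀ * F₁ ≡ (F₀ + 1ℚ) * u * c₀)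
    components = ⟨,⟩-injective (begin
      ⟨ F₀ * F₀ * F₀ + 1ℚ , 3 * F₀ * F₀ * F₁ ⟩   ≡⟨ cube⊕1-ℚ[ε] F₀ F₁ ⟨
      cube ⟨ F₀ , F₁ ⟩ ⊕ ι 1ℚ                     ≡⟨ cong (λ F → cube F ⊕ ι 1ℚ) {eval x f} {⟨ F₀ , F₁ ⟩} f[x]≡F ⟨
      cube (eval x f) ⊕ ι 1ℚ                      ≡⟨ eval-cubeₚ+oneₚ x f ⟨
      eval x (cubeₚ f +ₚ oneₚ)                    ≡⟨ f³+1[x]≡g[x]c ⟩
      eval x g ⊗ ⟨ c₀ , c₁ ⟩                      ≡⟨ cong (_⊗ ⟨ c₀ , c₁ ⟩) {eval x g} {⟨ 0ℚ , (F₀ + 1ℚ) * u ⟩} g[x]≡ ⟩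
      ⟨ 0ℚ , (F₀ + 1ℚ) * u ⟩ ⊗ ⟨ c₀ , c₁ ⟩        ≡⟨ ε-multiple-ℚ[ε] ((F₀ + 1ℚ) * u) c₀ c₁ ⟩
      ⟨ 0ℚ , (F₀ + 1ℚ) * u * c₀ ⟩                 ∎)
  w≡0 : w ≡ 0ℚ
  w≡0 = x*y≡0⇒y≡0 {2 * a} (*-≢0 {2} (λ ()) a≢0) (F₁≡0 (proj₁ cofactor) (proj₂ cofactor))
    where cofactor = eval-∣ₚ x g (cubeₚ f +ₚ oneₚ) g∣f³+1

g≈[f+1]R⇒v≡0 : ∀ {f g a σ s u v} → a ≢ 0ℚ → u ≢ 0ℚ →
  f ≈ₚ quadraticₚ a σ s → g ≈ₚ quadraticₚ a σ s *ₚ linearₚ σ u v +ₚ linearₚ σ u v → g ∣ₚ cubeₚ f +ₚ oneₚ → v ≡ 0ℚ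
g≈[f+1]R⇒v≡0 {f} {g} {a} {σ} {s} {u} {v} a≢0 u≢0 = double-root-at {f} {g} {a} {σ} {s} {u} {v} a≢0 (root (*-inverseʳ u))
  where
  instance _ = ≢-nonZero u≢0
  root : ∀ {i} → u * i ≡ 1ℚ → u * - (v * i) + v ≡ 0ℚ
  root {i} ui≡1 = combine₁ ui≡1 (- v) (solve (u ∷ v ∷ i ∷ []) ℚ-ring)

-- Elimination

u≡0⇒relations-solved : ∀ {a s l y v} → a ≢ 0ℚ → l ≢ 0ℚ →
  v * v * v + 3 * v * (0ℚ * 0ℚ * s) + 1ℚ ≡ 0ℚ →
  (a * l * (y * y * y - v * v * v) ≡ (l * l * l - 0ℚ * 0ℚ * 0ℚ) * (v - a * s * y)) ×
  (3 * a * l * (l * y * y - 0ℚ * v * v) ≡ (l * l * l - 0ℚ * 0ℚ * 0ℚ) * (0ℚ - a * s * l)) ×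
  ((2 * (l * l * l) + 0ℚ * 0ℚ * 0ℚ) * y ≡ 3 * l * (0ℚ * 0ℚ) * v) →
  (v ≡ - 1ℚ) × (y ≡ 0ℚ) × (s ≡ 0ℚ) × (a ≡ - (l * l))
u≡0⇒relations-solved {a} {s} {l} {y} {v} a≢0 l≢0 cube≡-1 (rel₀ , rel₁ , rel₂) = v≡-1 , y≡0 , s≡0 , a≡-l²
  where
  l³≢0 = *-≢0 (*-≢0 l≢0 l≢0) l≢0
  v≡-1 : v ≡ - 1ℚ
  v≡-1 = cube-injective (combine₁ cube≡-1 1ℚ (solve (v ∷ s ∷ []) ℚ-ring))
  y≡0 : y ≡ 0ℚ
  y≡0 = x*y≡0⇒y≡0 {2 * (l * l * l)} (*-≢0 {2} (λ ()) l³≢0) (combine₁ rel₂ 1ℚ (solve (l ∷ y ∷ v ∷ []) ℚ-ring))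
  s≡0 : s ≡ 0ℚ
  s≡0 = x*y≡0⇒y≡0 {a * (l * l * l * l)} (*-≢0 a≢0 (*-≢0 l³≢0 l≢0))
    (combine₂ rel₁ y≡0 1ℚ (- (3 * a * l * l * y)) (solve (a ∷ s ∷ l ∷ y ∷ v ∷ []) ℚ-ring))
  a≡-l² : a ≡ - (l * l)
  a≡-l² = x-y≡0⇒x≡y (x*y≡0⇒y≡0 l≢0
    (combine₃ rel₀ y≡0 v≡-1 1ℚ (- (a * l * (y * y + l * l * s))) (a * l * (v * v - v + 1ℚ) + l * l * l)
      (solve (a ∷ s ∷ l ∷ y ∷ v ∷ []) ℚ-ring)))

u≢0⇒v≡½ : ∀ {s u v} → u ≢ 0ℚ → v * v * v + 3 * v * (u * u * s) + 1ℚ ≡ 0ℚ → u * (3 * v * v + u * u * s) ≡ 0ℚ →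
  (v ≡ ½) × (3 * v * v + u * u * s ≡ 0ℚ)
u≢0⇒v≡½ {s} {u} {v} u≢0 cube≡-1 im≡0 = v≡½ , 3v²+u²s≡0
  where
  3v²+u²s≡0 = x*y≡0⇒y≡0 u≢0 im≡0
  2v≡1 : 2 * v ≡ 1ℚ
  2v≡1 = cube-injective (combine₂ cube≡-1 3v²+u²s≡0 (- 1ℚ) (3 * v) (solve (s ∷ u ∷ v ∷ []) ℚ-ring))
  v≡½ : v ≡ ½
  v≡½ = combine₁ 2v≡1 ½ (solve (v ∷ []) ℚ-ring)

3c²+5c+1≢0 : ∀ c → 3 * c * c + 5 * c + 1ℚ ≢ 0ℚ
3c²+5c+1≢0 c eq = square≢prime (from-yes (prime? 13)) (6 * c + 5) (combine₁ eq 12 (solve (c ∷ []) ℚ-ring))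

-- With v = ½ and u² s = −¾, eliminating a and s from the first two relations.
relations⇒W≡0 : ∀ {a s l y u} → a ≢ 0ℚ → 3 * ½ * ½ + u * u * s ≡ 0ℚ →
  a * l * (y * y * y - ½ * ½ * ½) ≡ (l * l * l - u * u * u) * (½ - a * s * y) →
  3 * a * l * (l * y * y - u * ½ * ½) ≡ (l * l * l - u * u * u) * (u - a * s * l) →
  8 * u * u * u * l * y * y * y - 12 * u * u * l * l * y * y - 6 * u * (l * l * l - u * u * u) * y
    + 2 * u * u * u * l + 3 * (l * l * l - u * u * u) * l ≡ 0ℚ
relations⇒W≡0 {a} {s} {l} {y} {u} a≢0 u²s≡-¾ rel₀ rel₁ = x*y≡0⇒y≡0 a≢0
  (combine₃ rel₀ rel₁ u²s≡-¾ (8 * u * u * u) (- (4 * u * u)) (4 * (l * l * l - u * u * u) * a * (l - 2 * u * y))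
    (solve (a ∷ s ∷ l ∷ y ∷ u ∷ []) ℚ-ring))

-- For l = m u, eliminating y (through w = (2 m³ + 1) y = 3 m / 2) leaves 8 m (m³ − 1)² (3 m⁶ + 5 m³ + 1) = 0.
ratio≡1 : ∀ {l m u y} → l ≡ m * u → u ≢ 0ℚ → m ≢ 0ℚ →
  8 * u * u * u * l * y * y * y - 12 * u * u * l * l * y * y - 6 * u * (l * l * l - u * u * u) * y
    + 2 * u * u * u * l + 3 * (l * l * l - u * u * u) * l ≡ 0ℚ →
  (2 * (l * l * l) + u * u * u) * y ≡ 3 * l * (u * u) * ½ → m ≡ 1ℚ
ratio≡1 {m = m} {u} {y} refl u≢0 m≢0 W≡0 rel₂ with m * m * m - 1ℚ ≟ 0ℚ
... | yes m³-1≡0 = cube-injective (x-y≡0⇒x≡y m³-1≡0)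
... | no m³-1≢0 = ⊥-elim (3c²+5c+1≢0 (m * m * m)
  (x*y≡0⇒y≡0 (*-≢0 m³-1≢0 m³-1≢0) (x*y≡0⇒y≡0 (*-≢0 {8} (λ ()) m≢0) resultant≡0)))
  where
  u³≢0 = *-≢0 (*-≢0 u≢0 u≢0) u≢0
  W′≡0 : 8 * m * y * y * y - 12 * m * m * y * y - 6 * (m * m * m - 1ℚ) * y + 3 * m * m * m * m - m ≡ 0ℚ
  W′≡0 = x*y≡0⇒y≡0 {u * u * u * u} (*-≢0 u³≢0 u≢0) (combine₁ W≡0 1ℚ (solve (m ∷ u ∷ y ∷ []) ℚ-ring))
  Dy≡ : (2 * (m * m * m) + 1ℚ) * y ≡ 3 * m * ½
  Dy≡ = x-y≡0⇒x≡y (x*y≡0⇒y≡0 {u * u * u} u³≢0 (combine₁ rel₂ 1ℚ (solve (m ∷ u ∷ y ∷ []) ℚ-ring)))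
  resultant≡0 : 8 * m * ((m * m * m - 1ℚ) * (m * m * m - 1ℚ) * (3 * (m * m * m) * (m * m * m) + 5 * (m * m * m) + 1ℚ)) ≡ 0ℚ
  resultant≡0 = begin
    8 * m * ((m * m * m - 1ℚ) * (m * m * m - 1ℚ) * (3 * (m * m * m) * (m * m * m) + 5 * (m * m * m) + 1ℚ))
      ≡⟨ resultant m ⟩
    8 * m * (3 * m * ½) * (3 * m * ½) * (3 * m * ½) - 12 * m * m * D * (3 * m * ½) * (3 * m * ½)
      - 6 * (m * m * m - 1ℚ) * D * D * (3 * m * ½) + (3 * m * m * m * m - m) * D * D * D
      ≡⟨ cong (λ w → 8 * m * w * w * w - 12 * m * m * D * w * w - 6 * (m * m * m - 1ℚ) * D * D * w + (3 * m * m * m * m - m) * D * D * D) Dy≡ ⟨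
    8 * m * (D * y) * (D * y) * (D * y) - 12 * m * m * D * (D * y) * (D * y)
      - 6 * (m * m * m - 1ℚ) * D * D * (D * y) + (3 * m * m * m * m - m) * D * D * D
      ≡⟨ homogeneous m y D ⟩
    D * D * D * (8 * m * y * y * y - 12 * m * m * y * y - 6 * (m * m * m - 1ℚ) * y + 3 * m * m * m * m - m)
      ≡⟨ cong (D * D * D *_) W′≡0 ⟩
    D * D * D * 0ℚ
      ≡⟨ ℚ.*-zeroʳ (D * D * D) ⟩
    0ℚ ∎
    where
    open ≡-Reasoning
    D = 2 * (m * m * m) + 1ℚ
    resultant : ∀ m → let D = 2 * (m * m * m) + 1ℚ in
      8 * m * ((m * m * m - 1ℚ) * (m * m * m - 1ℚ) * (3 * (m * m * m) * (m * m * m) + 5 * (m * m * m) + 1ℚ)) ≡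
      8 * m * (3 * m * ½) * (3 * m * ½) * (3 * m * ½) - 12 * m * m * D * (3 * m * ½) * (3 * m * ½)
        - 6 * (m * m * m - 1ℚ) * D * D * (3 * m * ½) + (3 * m * m * m * m - m) * D * D * D
    resultant m = solve (m ∷ []) ℚ-ring
    homogeneous : ∀ m y D →
      8 * m * (D * y) * (D * y) * (D * y) - 12 * m * m * D * (D * y) * (D * y)
        - 6 * (m * m * m - 1ℚ) * D * D * (D * y) + (3 * m * m * m * m - m) * D * D * D ≡
      D * D * D * (8 * m * y * y * y - 12 * m * m * y * y - 6 * (m * m * m - 1ℚ) * y + 3 * m * m * m * m - m)
    homogeneous m y D = solve (m ∷ y ∷ D ∷ []) ℚ-ring

l≡u : ∀ {l u y} → l ≢ 0ℚ → u ≢ 0ℚ →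
  8 * u * u * u * l * y * y * y - 12 * u * u * l * l * y * y - 6 * u * (l * l * l - u * u * u) * y
    + 2 * u * u * u * l + 3 * (l * l * l - u * u * u) * l ≡ 0ℚ →
  (2 * (l * l * l) + u * u * u) * y ≡ 3 * l * (u * u) * ½ → l ≡ u
l≡u {l} {u} {y} l≢0 u≢0 W≡0 rel₂ = begin
  l           ≡⟨ mu≡l ⟨
  l * 1/ u * u ≡⟨ cong (_* u) (ratio≡1 (sym mu≡l) u≢0 m≢0 W≡0 rel₂) ⟩
  1ℚ * u      ≡⟨ ℚ.*-identityˡ u ⟩
  u           ∎
  where
  open ≡-Reasoning
  instance _ = ≢-nonZero u≢0
  cancel : ∀ {i} → u * i ≡ 1ℚ → l * i * u ≡ l
  cancel {i} ui≡1 = combine₁ ui≡1 l (solve (l ∷ u ∷ i ∷ []) ℚ-ring)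
  mu≡l : l * 1/ u * u ≡ l
  mu≡l = cancel (*-inverseʳ u)
  m≢0 : l * 1/ u ≢ 0ℚ
  m≢0 m≡0 = l≢0 (trans (sym mu≡l) (trans (cong (_* u) m≡0) (ℚ.*-zeroˡ u)))

y≡½ : ∀ {u y} → u ≢ 0ℚ → (2 * (u * u * u) + u * u * u) * y ≡ 3 * u * (u * u) * ½ → y ≡ ½
y≡½ {u} {y} u≢0 rel₂ =
  x-y≡0⇒x≡y (x*y≡0⇒y≡0 {3 * (u * u * u)} (*-≢0 {3} (λ ()) (*-≢0 (*-≢0 u≢0 u≢0) u≢0)) (combine₁ rel₂ 1ℚ (solve (u ∷ y ∷ []) ℚ-ring)))

u≢0⇒L≡R : ∀ {a s l y u v} → a ≢ 0ℚ → l ≢ 0ℚ → u ≢ 0ℚ →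
  (v ≡ ½) × (3 * v * v + u * u * s ≡ 0ℚ) →
  (a * l * (y * y * y - v * v * v) ≡ (l * l * l - u * u * u) * (v - a * s * y)) ×
  (3 * a * l * (l * y * y - u * v * v) ≡ (l * l * l - u * u * u) * (u - a * s * l)) ×
  ((2 * (l * l * l) + u * u * u) * y ≡ 3 * l * (u * u) * v) →
  (l ≡ u) × (y ≡ ½)
u≢0⇒L≡R {a} {s} {l} {y} {u} a≢0 l≢0 u≢0 (refl , u²s≡-¾) (rel₀ , rel₁ , rel₂) =
  l≡u′ , y≡½ u≢0 (subst (λ l → (2 * (l * l * l) + u * u * u) * y ≡ 3 * l * (u * u) * ½) l≡u′ rel₂)
  where l≡u′ = l≡u l≢0 u≢0 (relations⇒W≡0 {a} {s} {l} {y} {u} a≢0 u²s≡-¾ rel₀ rel₁) rel₂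

module _ (α β : ℚ) where
  F∘lin : Poly
  F∘lin = - (β * β) ∷ - (2 * α * β) ∷ - (α * α) ∷ []

  G∘lin : Poly
  G∘lin = β * β * β - 1ℚ ∷ 3 * α * β * β ∷ 3 * α * α * β ∷ α * α * α ∷ []

  -- F³ + 1 = G · (− (t³ + 1)) at t = α t + β
  H∘lin : Poly
  H∘lin = - (β * β * β + 1ℚ) ∷ - (3 * α * β * β) ∷ - (3 * α * α * β) ∷ - (α * α * α) ∷ []

  -- G³ + 1 = F · (− t (t⁶ − 3 t³ + 3)) at t = α t + β
  K∘lin : Poly
  K∘lin = - (β * β * β * β * β * β * β) + 3 * β * β * β * β - 3 * β
        ∷ - (7 * α * β * β * β * β * β * β) + 12 * α * β * β * β - 3 * α
        ∷ - (21 * α * α * β * β * β * β * β) + 18 * α * α * β * β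
        ∷ - (35 * α * α * α * β * β * β * β) + 12 * α * α * α * β
        ∷ - (35 * α * α * α * α * β * β * β) + 3 * α * α * α * α
        ∷ - (21 * α * α * α * α * α * β * β)
        ∷ - (7 * α * α * α * α * α * α * β)
        ∷ - (α * α * α * α * α * α * α) ∷ []

  composeₚ-Fₚ : composeₚ Fₚ (linₚ α β) ≋ F∘lin
  composeₚ-Fₚ = solve vars ℚ-ring ∷ solve vars ℚ-ring ∷ solve vars ℚ-ring ∷ solve vars ℚ-ring ∷0 []
    where vars = α ∷ β ∷ []

  composeₚ-Gₚ : composeₚ Gₚ (linₚ α β) ≋ G∘lin
  composeₚ-Gₚ = solve vars ℚ-ring ∷ solve vars ℚ-ring ∷ solve vars ℚ-ring ∷ solve vars ℚ-ring ∷ solve vars ℚ-ring ∷0 []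
    where vars = α ∷ β ∷ []

  G∘lin*H∘lin≋F∘lin³+1 : G∘lin *ₚ H∘lin ≋ cubeₚ F∘lin +ₚ oneₚ
  G∘lin*H∘lin≋F∘lin³+1 = solve vars ℚ-ring ∷ solve vars ℚ-ring ∷ solve vars ℚ-ring ∷ solve vars ℚ-ring ∷
    solve vars ℚ-ring ∷ solve vars ℚ-ring ∷ solve vars ℚ-ring ∷ []
    where vars = α ∷ β ∷ []

  F∘lin*K∘lin≋G∘lin³+1 : F∘lin *ₚ K∘lin ≋ cubeₚ G∘lin +ₚ oneₚ
  F∘lin*K∘lin≋G∘lin³+1 = solve vars ℚ-ring ∷ solve vars ℚ-ring ∷ solve vars ℚ-ring ∷ solve vars ℚ-ring ∷
    solve vars ℚ-ring ∷ solve vars ℚ-ring ∷ solve vars ℚ-ring ∷ solve vars ℚ-ring ∷ solve vars ℚ-ring ∷ solve vars ℚ-ring ∷ []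
    where vars = α ∷ β ∷ []

FG-Reparametrisation : Poly → Poly → Set
FG-Reparametrisation f g =
  Σ ℚ (λ α → Σ ℚ (λ β → (α ≢ 0ℚ) × (f ≈ₚ composeₚ Fₚ (linₚ α β)) × (g ≈ₚ composeₚ Gₚ (linₚ α β))))

backward : ∀ {f g} → FG-Reparametrisation f g → (g ∣ₚ cubeₚ f +ₚ oneₚ) × (f ∣ₚ cubeₚ g +ₚ oneₚ)
backward {f} {g} (α , β , _ , f≈ , g≈) =
  ∣ₚ-cube+1-resp-≈ₚ {G∘lin α β} {g} {F∘lin α β} {f} G≈g F≈f (H∘lin α β , ≋⇒≈ₚ (G∘lin*H∘lin≋F∘lin³+1 α β)) ,
  ∣ₚ-cube+1-resp-≈ₚ {F∘lin α β} {f} {G∘lin α β} {g} F≈f G≈g (K∘lin α β , ≋⇒≈ₚ (F∘lin*K∘lin≋G∘lin³+1 α β))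
  where
  open ≈ₚ-Reasoning
  F≈f : F∘lin α β ≈ₚ f
  F≈f = begin
    F∘lin α β                  ≈⟨ ≋⇒≈ₚ (composeₚ-Fₚ α β) ⟨
    composeₚ Fₚ (linₚ α β)     ≈⟨ f≈ ⟨
    f                          ∎
  G≈g : G∘lin α β ≈ₚ g
  G≈g = begin
    G∘lin α β                  ≈⟨ ≋⇒≈ₚ (composeₚ-Gₚ α β) ⟨
    composeₚ Gₚ (linₚ α β)     ≈⟨ g≈ ⟨
    g                          ∎

u≡0-solution : ∀ {f g a σ s l y v} → l ≢ 0ℚ → (v ≡ - 1ℚ) × (y ≡ 0ℚ) × (s ≡ 0ℚ) × (a ≡ - (l * l)) →
  f ≈ₚ quadraticₚ a σ s → g ≈ₚ quadraticₚ a σ s *ₚ linearₚ σ l y +ₚ linearₚ σ 0ℚ v → FG-Reparametrisation f g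
u≡0-solution {f} {g} {σ = σ} {l = l} l≢0 (refl , refl , refl , refl) f≈ g≈ =
  - l , - (l * σ) , (λ -l≡0 → l≢0 (neg-injective -l≡0)) , f≈F∘ℓ , g≈G∘ℓ
  where
  open ≈ₚ-Reasoning
  ℓ = linₚ (- l) (- (l * σ))
  vars = l ∷ σ ∷ []
  f-expanded : quadraticₚ (- (l * l)) σ 0ℚ ≋ F∘lin (- l) (- (l * σ))
  f-expanded = solve vars ℚ-ring ∷ solve vars ℚ-ring ∷ solve vars ℚ-ring ∷ []
  g-expanded : quadraticₚ (- (l * l)) σ 0ℚ *ₚ linearₚ σ l 0ℚ +ₚ linearₚ σ 0ℚ (- 1ℚ) ≋ G∘lin (- l) (- (l * σ))
  g-expanded = solve vars ℚ-ring ∷ solve vars ℚ-ring ∷ solve vars ℚ-ring ∷ solve vars ℚ-ring ∷ []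
  f≈F∘ℓ : f ≈ₚ composeₚ Fₚ ℓ
  f≈F∘ℓ = begin
    f                                 ≈⟨ f≈ ⟩
    quadraticₚ (- (l * l)) σ 0ℚ       ≈⟨ ≋⇒≈ₚ f-expanded ⟩
    F∘lin (- l) (- (l * σ))           ≈⟨ ≋⇒≈ₚ (composeₚ-Fₚ (- l) (- (l * σ))) ⟨
    composeₚ Fₚ ℓ                     ∎
  g≈G∘ℓ : g ≈ₚ composeₚ Gₚ ℓ
  g≈G∘ℓ = begin
    g                                                                          ≈⟨ g≈ ⟩
    quadraticₚ (- (l * l)) σ 0ℚ *ₚ linearₚ σ l 0ℚ +ₚ linearₚ σ 0ℚ (- 1ℚ)      ≈⟨ ≋⇒≈ₚ g-expanded ⟩
    G∘lin (- l) (- (l * σ))                                                    ≈⟨ ≋⇒≈ₚ (composeₚ-Gₚ (- l) (- (l * σ))) ⟨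
    composeₚ Gₚ ℓ                                                              ∎

u≢0-impossible : ∀ {f g} (N : NormalForm f g) → NormalForm.u N ≢ 0ℚ →
  g ∣ₚ cubeₚ f +ₚ oneₚ → f ∣ₚ cubeₚ g +ₚ oneₚ → ⊥
u≢0-impossible {f} {g} N@(normalForm a σ s l y u v a≢0 l≢0 f≈ g≈) u≢0 g∣f³+1 f∣g³+1 = ½≢0 (trans (sym v≡½) v≡0)
  where
  ½≢0 : ½ ≢ 0ℚ
  ½≢0 ()
  remainder = u≢0⇒v≡½ {s} {u} {v} u≢0 (proj₁ (f∣g³+1⇒R[√s]³≡-1 N f∣g³+1)) (proj₂ (f∣g³+1⇒R[√s]³≡-1 N f∣g³+1))
  v≡½ = proj₁ remainder
  l≡u×y≡½ = u≢0⇒L≡R {a} {s} {l} {y} {u} {v} a≢0 l≢0 u≢0 remainder (g∣f³+1⇒relations N g∣f³+1)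
  g≈fR+R : g ≈ₚ quadraticₚ a σ s *ₚ linearₚ σ u v +ₚ linearₚ σ u v
  g≈fR+R = subst₂ (λ l′ y′ → g ≈ₚ quadraticₚ a σ s *ₚ linearₚ σ l′ y′ +ₚ linearₚ σ u v)
    (proj₁ l≡u×y≡½) (trans (proj₂ l≡u×y≡½) (sym v≡½)) g≈
  v≡0 = g≈[f+1]R⇒v≡0 {f} {g} {a} {σ} {s} {u} {v} a≢0 u≢0 f≈ g≈fR+R g∣f³+1

from-normal-form : ∀ {f g} → NormalForm f g → (g ∣ₚ cubeₚ f +ₚ oneₚ) × (f ∣ₚ cubeₚ g +ₚ oneₚ) → FG-Reparametrisation f g
from-normal-form {f} {g} N@(normalForm a σ s l y u v a≢0 l≢0 f≈ g≈) (g∣f³+1 , f∣g³+1) with u ≟ 0ℚ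
... | no u≢0 = ⊥-elim (u≢0-impossible N u≢0 g∣f³+1 f∣g³+1)
... | yes refl = u≡0-solution {f} {g} {a} {σ} {s} {l} {y} {v} l≢0
  (u≡0⇒relations-solved a≢0 l≢0 (proj₁ (f∣g³+1⇒R[√s]³≡-1 N f∣g³+1)) (g∣f³+1⇒relations N g∣f³+1)) f≈ g≈

theorem2p3 : (f g : Poly) → HasDegree f 2 → HasDegree g 3 →
    ((g ∣ₚ (cubeₚ f +ₚ oneₚ)) × (f ∣ₚ (cubeₚ g +ₚ oneₚ)))
      ⇔ Σ ℚ (λ α → Σ ℚ (λ β → (α ≢ 0ℚ) × (f ≈ₚ composeₚ Fₚ (linₚ α β)) × (g ≈ₚ composeₚ Gₚ (linₚ α β))))
theorem2p3 f g f² g³ = mk⇔ (from-normal-form (normal-form {f} {g} f² g³)) (backward {f} {g})
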